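{- Let $\Phi=\{4321,\,34512,\,45123,\,35412,\,43512,\,45132,\,45213,\,53412,\,45312,\,45231\}$ and let $w\in\mathfrak{S}_N$. If $w$ has an $N$-occurrence of at least one of the patterns in $\Phi$, then $|\mathrm{newrep}(w)|<[321;3412]_N(w)$.
   Context: Permutations are written in one-line notation; $s_i$ is the simple reflection interchanging $i$ and $i+1$; $\mathrm{supp}(u)$ is the set of distinct simple reflections appearing in a reduced decomposition of $u$ (independent of the choice). An occurrence of a pattern $p\in\mathfrak{S}_k$ in $w$ is a subsequence $w(i_1)\cdots w(i_k)$, $i_1<\cdots<i_k$, in the same relative order as $p$; it is an $N$-occurrence if its largest value is $N$. $[321;3412]_N(w)$ is the number of $N$-occurrences of $321$ in $w$ plus the number of $N$-occurrences of $3412$ in $w$. For $w\in\mathfrak{S}_N$, $\overline{w}\in\mathfrak{S}_{N-1}$ is obtained by deleting the letter $N$ from the one-line notation of $w$, and $\mathrm{newrep}(w)=\{k:\ s_k\in\mathrm{supp}(\overline{w}),\ w^{ -1}(N)\le k\}$. -}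

module Defs where

open import Data.Nat using (ℕ; zero; suc; _+_; _<_; _≤_; _<ᵇ_; _≡ᵇ_; _⊔_)
open import Data.Bool using (Bool; true; false; _∧_; not; if_then_else_)
open import Data.List using (List; []; _∷_; _++_; map; length; filterᵇ; foldr; foldl; upTo)
open import Data.List.Relation.Unary.All using (All)
open import Data.List.Membership.Propositional using (_∈_)
open import Data.List.Relation.Binary.Permutation.Propositional using (_↭_)
open import Data.Product using (Σ; ∃; _×_; _,_)
open import Relation.Binary.PropositionalEquality using (_≡_; _≢_)
open import Relation.Nullary using (¬_)

-- Permutations are lists in one-line notation with values 1..N.
range1 : ℕ → List ℕ
range1 n = map suc (upTo n)

IsPerm : ℕ → List ℕ → Set
IsPerm N w = w ↭ range1 N

_==ᴸ_ : List ℕ → List ℕ → Bool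
[] ==ᴸ [] = true
(x ∷ xs) ==ᴸ (y ∷ ys) = (x ≡ᵇ y) ∧ (xs ==ᴸ ys)
_ ==ᴸ _ = false

subseqs : List ℕ → List (List ℕ)
subseqs [] = [] ∷ []
subseqs (x ∷ xs) = map (x ∷_) (subseqs xs) ++ subseqs xs

std : List ℕ → List ℕ
std s = map (λ x → suc (length (filterᵇ (λ y → y <ᵇ x) s))) s

maxL : List ℕ → ℕ
maxL = foldr _⊔_ 0

nOcc : ℕ → List ℕ → List ℕ → ℕ
nOcc N p w = length (filterᵇ (λ s → (std s ==ᴸ p) ∧ (maxL s ≡ᵇ N)) (subseqs w))

count321-3412 : ℕ → List ℕ → ℕ
count321-3412 N w = nOcc N (3 ∷ 2 ∷ 1 ∷ []) w + nOcc N (3 ∷ 4 ∷ 1 ∷ 2 ∷ []) w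

HasNOcc : ℕ → List ℕ → List ℕ → Set
HasNOcc N p w = 0 < nOcc N p w

delN : ℕ → List ℕ → List ℕ
delN N = filterᵇ (λ x → not (x ≡ᵇ N))

-- 1-indexed position of the letter a in w, i.e. w⁻¹(a)
posOf : ℕ → List ℕ → ℕ
posOf a [] = 1
posOf a (x ∷ xs) = if x ≡ᵇ a then 1 else suc (posOf a xs)

-- swap the entries in positions k and k+1 (1-indexed); right multiplication by s_k
swapPos : List ℕ → ℕ → List ℕ
swapPos (x ∷ y ∷ xs) 1 = y ∷ x ∷ xs
swapPos (x ∷ xs) (suc (suc k)) = x ∷ swapPos xs (suc k)
swapPos xs _ = xs

-- the permutation s_{a₁} s_{a₂} ⋯ s_{aₘ} in 𝔖_n, in one-line notation
wordPerm : ℕ → List ℕ → List ℕ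
wordPerm n ws = foldl swapPos (range1 n) ws

IsWord : ℕ → List ℕ → Set
IsWord n ws = All (λ a → 1 ≤ a × suc a ≤ n) ws

IsReduced : ℕ → List ℕ → List ℕ → Set
IsReduced n u ws =
  IsWord n ws × wordPerm n ws ≡ u ×
  (∀ vs → IsWord n vs → wordPerm n vs ≡ u → length ws ≤ length vs)

InSupp : ℕ → List ℕ → ℕ → Set
InSupp n u k = Σ (List ℕ) λ ws → IsReduced n u ws × k ∈ ws

InNewrep : ℕ → List ℕ → ℕ → Set
InNewrep N w k = InSupp (N Data.Nat.∸ 1) (delN N w) k × posOf N w ≤ k

Φ : List (List ℕ)
Φ = (4 ∷ 3 ∷ 2 ∷ 1 ∷ [])
  ∷ (3 ∷ 4 ∷ 5 ∷ 1 ∷ 2 ∷ [])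
  ∷ (4 ∷ 5 ∷ 1 ∷ 2 ∷ 3 ∷ [])
  ∷ (3 ∷ 5 ∷ 4 ∷ 1 ∷ 2 ∷ [])
  ∷ (4 ∷ 3 ∷ 5 ∷ 1 ∷ 2 ∷ [])
  ∷ (4 ∷ 5 ∷ 1 ∷ 3 ∷ 2 ∷ [])
  ∷ (4 ∷ 5 ∷ 2 ∷ 1 ∷ 3 ∷ [])
  ∷ (5 ∷ 3 ∷ 4 ∷ 1 ∷ 2 ∷ [])
  ∷ (4 ∷ 5 ∷ 3 ∷ 1 ∷ 2 ∷ [])
  ∷ (4 ∷ 5 ∷ 2 ∷ 3 ∷ 1 ∷ [])
  ∷ []

-- Write w = A ++ N ∷ B. If s_k lies in the support of w̄ = A ++ B then some letter at most k follows
-- position k of w̄ (each letter of a reduced word adds one inversion, and s_k adds one across cut k),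
-- so newrep(w) consists of cuts k > |A| that B makes escape in this sense. Build B letter by letter:
-- appending z makes at most (#larger letters of B) + (#smaller letters of B)·(#larger letters of A)
-- new cuts escape, and that is exactly the number of new N-occurrences N y z of 321 and a N x z of
-- 3412. Hence |newrep(w)| ≤ [321;3412]_N(w), and an N-occurrence of a pattern of Φ forces one step in
-- which z either hits an already escaped cut or completes strictly more occurrences than cuts.

module Submission where

open import Data.Bool using (Bool; true; false; _∧_; _∨_; if_then_else_; T)
open import Data.Bool.Properties using (T-≡; ∨-assoc; ∨-identityʳ; ∧-identityʳ; ∧-zeroʳ)
open import Data.Empty using (⊥-elim)
open import Data.List
  using (List; []; _∷_; _++_; map; length; filterᵇ; foldl; applyUpTo; take; drop)
open import Data.List.Properties
  using ( ++-identityʳ; ++-assoc; length-++; length-++-≤ˡ; foldl-++; take++drop≡id; length-take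
        ; map-cong; ∷-injective; drop-[])
open import Data.List.Membership.Propositional using (_∈_; _∉_)
open import Data.List.Membership.Propositional.Properties
  using (∈-∃++; ∈-++⁺ˡ; ∈-++⁺ʳ; ∈-++⁻; ∈-filter⁺; ∈-filter⁻)
open import Data.List.Relation.Binary.Permutation.Propositional
  using (_↭_; ↭-sym; ↭⇒↭ₛ) renaming (refl to ↭-refl; trans to ↭-trans; swap to ↭-swap)
import Data.List.Relation.Binary.Permutation.Setoid.Properties as ↭ₛ
open import Data.List.Relation.Binary.Permutation.Propositional.Properties
  using (∈-resp-↭; ↭-length; ↭-empty-inv; drop-∷; drop-mid; ++⁺ˡ)
open import Data.List.Relation.Binary.Pointwise using (Pointwise; []; _∷_)
open import Data.List.Relation.Binary.Sublist.Propositional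
  using (_⊆_; []; _∷_; _∷ʳ_) renaming (lookup to ⊆-lookup)
open import Data.List.Relation.Unary.All using (All; []; _∷_; lookup; tabulate; all?)
open import Data.List.Relation.Unary.All.Properties using (++⁺; ++⁻ˡ; ++⁻ʳ)
open import Data.List.Relation.Unary.Any using (here; there)
open import Data.List.Relation.Unary.Unique.Propositional using (Unique; []; _∷_)
open import Data.List.Relation.Unary.Unique.Propositional.Properties using (filter⁺)
open import Data.Nat
  using (ℕ; zero; suc; _+_; _*_; _∸_; _<_; _≤_; _<ᵇ_; _≤ᵇ_; _≡ᵇ_; _⊔_; _⊓_; z≤n; s≤s; _≟_; _<?_; _≤?_)
open import Data.Bool.ListAction using (any)
open import Data.Nat.ListAction using (sum)
open import Data.Nat.Properties
open import Data.Nat.Solver using (module +-*-Solver)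
open import Data.Product using (Σ; _×_; _,_; proj₁; proj₂)
open import Data.Sum using (_⊎_; inj₁; inj₂)
open import Function using (_∘_)
open import Function.Bundles using (_⇔_; Equivalence)
open import Relation.Binary.PropositionalEquality
  using (_≡_; _≢_; refl; sym; trans; cong; cong₂; subst; subst₂; setoid; module ≡-Reasoning)
open import Relation.Binary.Definitions using (tri<; tri≈; tri>)
open import Relation.Nullary using (yes; no)
open import Relation.Nullary.Decidable using (T?; True; toWitness)

open import Defs

open +-*-Solver
open Equivalence using (to; from)

<⇒<ᵇ≡true : ∀ {m n} → m < n → (m <ᵇ n) ≡ true
<⇒<ᵇ≡true = to T-≡ ∘ <⇒<ᵇ

<ᵇ≡true⇒< : ∀ {m n} → (m <ᵇ n) ≡ true → m < n
<ᵇ≡true⇒< {m} {n} = <ᵇ⇒< m n ∘ from T-≡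

≥⇒<ᵇ≡false : ∀ {m n} → n ≤ m → (m <ᵇ n) ≡ false
≥⇒<ᵇ≡false {m} {n} n≤m with m <ᵇ n in eq
... | true = ⊥-elim (≤⇒≯ n≤m (<ᵇ≡true⇒< eq))
... | false = refl

<ᵇ≡false⇒≥ : ∀ {m n} → (m <ᵇ n) ≡ false → n ≤ m
<ᵇ≡false⇒≥ {m} {n} eq = ≮⇒≥ (λ m<n → subst T eq (<⇒<ᵇ m<n))

≤⇒≤ᵇ≡true : ∀ {m n} → m ≤ n → (m ≤ᵇ n) ≡ true
≤⇒≤ᵇ≡true = to T-≡ ∘ ≤⇒≤ᵇ

≤ᵇ≡true⇒≤ : ∀ {m n} → (m ≤ᵇ n) ≡ true → m ≤ n
≤ᵇ≡true⇒≤ {m} {n} = ≤ᵇ⇒≤ m n ∘ from T-≡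

≤ᵇ≡false⇒> : ∀ {m n} → (m ≤ᵇ n) ≡ false → n < m
≤ᵇ≡false⇒> {m} {n} eq = ≰⇒> (λ m≤n → subst T eq (≤⇒≤ᵇ m≤n))

≡ᵇ-refl : ∀ n → (n ≡ᵇ n) ≡ true
≡ᵇ-refl n = to T-≡ (≡⇒≡ᵇ n n refl)

≢⇒≡ᵇ≡false : ∀ {m n} → m ≢ n → (m ≡ᵇ n) ≡ false
≢⇒≡ᵇ≡false {m} {n} m≢n with m ≡ᵇ n in eq
... | true = ⊥-elim (m≢n (≡ᵇ⇒≡ m n (from T-≡ eq)))
... | false = refl

≡ᵇ≡true⇒≡ : ∀ {m n} → (m ≡ᵇ n) ≡ true → m ≡ n
≡ᵇ≡true⇒≡ {m} {n} = ≡ᵇ⇒≡ m n ∘ from T-≡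

∧≡true⇒ˡ : ∀ {a b} → (a ∧ b) ≡ true → a ≡ true
∧≡true⇒ˡ {true} _ = refl

∧≡true⇒ʳ : ∀ {a b} → (a ∧ b) ≡ true → b ≡ true
∧≡true⇒ʳ {true} eq = eq

∧≡true : ∀ {a b} → a ≡ true → b ≡ true → (a ∧ b) ≡ true
∧≡true refl refl = refl

count : {A : Set} → (A → Bool) → List A → ℕ
count P [] = 0
count P (x ∷ xs) = if P x then suc (count P xs) else count P xs

module _ {A : Set} where

  length-filterᵇ : ∀ (P : A → Bool) xs → length (filterᵇ P xs) ≡ count P xs
  length-filterᵇ P [] = refl
  length-filterᵇ P (x ∷ xs) with P x
  ... | true = cong suc (length-filterᵇ P xs)
  ... | false = length-filterᵇ P xs

  count-++ : ∀ (P : A → Bool) xs ys → count P (xs ++ ys) ≡ count P xs + count P ys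
  count-++ P [] ys = refl
  count-++ P (x ∷ xs) ys with P x
  ... | true = cong suc (count-++ P xs ys)
  ... | false = count-++ P xs ys

  count-map : ∀ (P : A → Bool) (f : A → A) xs → count P (map f xs) ≡ count (P ∘ f) xs
  count-map P f [] = refl
  count-map P f (x ∷ xs) with P (f x)
  ... | true = cong suc (count-map P f xs)
  ... | false = count-map P f xs

  count-cong : ∀ (P Q : A → Bool) → (∀ x → P x ≡ Q x) → ∀ xs → count P xs ≡ count Q xs
  count-cong P Q P≗Q [] = refl
  count-cong P Q P≗Q (x ∷ xs) rewrite P≗Q x with Q x
  ... | true = cong suc (count-cong P Q P≗Q xs)
  ... | false = count-cong P Q P≗Q xs

  count-mono : ∀ (P Q : A → Bool) → (∀ x → P x ≡ true → Q x ≡ true) →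
               ∀ xs → count P xs ≤ count Q xs
  count-mono P Q P⇒Q [] = z≤n
  count-mono P Q P⇒Q (x ∷ xs) with P x in eq
  ... | true rewrite P⇒Q x eq = s≤s (count-mono P Q P⇒Q xs)
  ... | false with Q x
  ...   | true = m≤n⇒m≤1+n (count-mono P Q P⇒Q xs)
  ...   | false = count-mono P Q P⇒Q xs

  count-∨ : ∀ (P Q : A → Bool) xs →
            count (λ x → P x ∨ Q x) xs + count (λ x → P x ∧ Q x) xs ≡ count P xs + count Q xs
  count-∨ P Q [] = refl
  count-∨ P Q (x ∷ xs) with P x | Q x
  ... | true  | true  = cong suc (trans (+-suc _ _) (trans (cong suc (count-∨ P Q xs)) (sym (+-suc _ _))))
  ... | true  | false = cong suc (count-∨ P Q xs)
  ... | false | true  = trans (cong suc (count-∨ P Q xs)) (sym (+-suc _ _))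
  ... | false | false = count-∨ P Q xs

  count≥1⇒∃ : ∀ (P : A → Bool) xs → 1 ≤ count P xs → Σ A λ x → x ∈ xs × P x ≡ true
  count≥1⇒∃ P (x ∷ xs) h with P x in eq
  ... | true = x , here refl , eq
  ... | false with count≥1⇒∃ P xs h
  ...   | y , y∈xs , Py = y , there y∈xs , Py

  ∃⇒count≥1 : ∀ (P : A → Bool) {x xs} → x ∈ xs → P x ≡ true → 1 ≤ count P xs
  ∃⇒count≥1 P {xs = y ∷ ys} (here refl) Px rewrite Px = s≤s z≤n
  ∃⇒count≥1 P {xs = y ∷ ys} (there x∈ys) Px with P y
  ... | true = s≤s z≤n
  ... | false = ∃⇒count≥1 P x∈ys Px

  count≡0⇒∀ : ∀ (P : A → Bool) xs → count P xs ≡ 0 → ∀ {x} → x ∈ xs → P x ≡ false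
  count≡0⇒∀ P xs c≡0 {x} x∈xs with P x in eq
  ... | false = refl
  ... | true with ∃⇒count≥1 P x∈xs eq
  ...   | c≥1 rewrite c≡0 = ⊥-elim (1+n≰n c≥1)

  ∀⇒count≡0 : ∀ (P : A → Bool) xs → (∀ {x} → x ∈ xs → P x ≡ false) → count P xs ≡ 0
  ∀⇒count≡0 P [] h = refl
  ∀⇒count≡0 P (x ∷ xs) h rewrite h (here refl) = ∀⇒count≡0 P xs (h ∘ there)

any-∈ : ∀ (P : ℕ → Bool) {x xs} → x ∈ xs → P x ≡ true → any P xs ≡ true
any-∈ P (here refl) Px rewrite Px = refl
any-∈ P {xs = y ∷ _} (there x∈) Px rewrite any-∈ P x∈ Px with P y
... | true = refl
... | false = refl

any≡false⇒ : ∀ (P : ℕ → Bool) xs → any P xs ≡ false → ∀ {x} → x ∈ xs → P x ≡ false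
any≡false⇒ P xs none {x} x∈ with P x in Px
... | true = trans (sym (any-∈ P x∈ Px)) none
... | false = refl

any-drop-snoc : ∀ (P : ℕ → Bool) j xs z →
  any P (drop j (xs ++ z ∷ [])) ≡ any P (drop j xs) ∨ ((j ≤ᵇ length xs) ∧ P z)
any-drop-snoc P zero [] z = ∨-identityʳ (P z)
any-drop-snoc P (suc j) [] z rewrite drop-[] {A = ℕ} j = refl
any-drop-snoc P zero (x ∷ xs) z =
  trans (cong (P x ∨_) (any-drop-snoc P zero xs z)) (sym (∨-assoc (P x) _ _))
any-drop-snoc P (suc j) (x ∷ xs) z =
  trans (any-drop-snoc P j xs z) (cong (λ b → any P (drop j xs) ∨ (b ∧ P z)) (≤ᵇ-suc j))
  where
  ≤ᵇ-suc : ∀ j → (j ≤ᵇ length xs) ≡ (suc j ≤ᵇ suc (length xs))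
  ≤ᵇ-suc zero = refl
  ≤ᵇ-suc (suc j) = refl

Unique-resp-↭ : ∀ {xs ys : List ℕ} → Unique xs → xs ↭ ys → Unique ys
Unique-resp-↭ u p = ↭ₛ.Unique-resp-↭ (setoid ℕ) (↭⇒↭ₛ p) u

Unique⇒length≤ : ∀ {xs ys : List ℕ} → Unique xs → (∀ {x} → x ∈ xs → x ∈ ys) →
                 length xs ≤ length ys
Unique⇒length≤ {[]} _ _ = z≤n
Unique⇒length≤ {x ∷ xs} {ys} (x∉xs ∷ u) xs⊆ys with ∈-∃++ (xs⊆ys (here refl))
... | P , Q , refl = begin
  suc (length xs)        ≤⟨ s≤s (Unique⇒length≤ u xs⊆P++Q) ⟩
  suc (length (P ++ Q))  ≡⟨ cong suc (length-++ P) ⟩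
  suc (length P + length Q) ≡⟨ +-suc (length P) (length Q) ⟨
  length P + length (x ∷ Q) ≡⟨ length-++ P ⟨
  length (P ++ x ∷ Q)    ∎
  where
  open ≤-Reasoning
  xs⊆P++Q : ∀ {y} → y ∈ xs → y ∈ P ++ Q
  xs⊆P++Q {y} y∈xs with ∈-++⁻ P (xs⊆ys (there y∈xs))
  ... | inj₁ y∈P = ∈-++⁺ˡ y∈P
  ... | inj₂ (here refl) = ⊥-elim (lookup x∉xs y∈xs refl)
  ... | inj₂ (there y∈Q) = ∈-++⁺ʳ P y∈Q

Unique-++⁻ˡ : ∀ (xs ys : List ℕ) → Unique (xs ++ ys) → Unique xs
Unique-++⁻ˡ [] ys u = []
Unique-++⁻ˡ (x ∷ xs) ys (x∉ ∷ u) = tabulate (lookup x∉ ∘ ∈-++⁺ˡ) ∷ Unique-++⁻ˡ xs ys u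

Unique-++-∷⇒∉ˡ : ∀ (xs : List ℕ) y ys → Unique (xs ++ y ∷ ys) → y ∉ xs
Unique-++-∷⇒∉ˡ (x ∷ xs) y ys (x∉ ∷ u) (here refl) = lookup x∉ (∈-++⁺ʳ xs (here refl)) refl
Unique-++-∷⇒∉ˡ (x ∷ xs) y ys (_ ∷ u) (there y∈xs) = Unique-++-∷⇒∉ˡ xs y ys u y∈xs

Unique-++-∷⇒∉ʳ : ∀ (xs : List ℕ) y ys → Unique (xs ++ y ∷ ys) → y ∉ ys
Unique-++-∷⇒∉ʳ [] y ys (y∉ ∷ u) y∈ys = lookup y∉ y∈ys refl
Unique-++-∷⇒∉ʳ (x ∷ xs) y ys (_ ∷ u) = Unique-++-∷⇒∉ʳ xs y ys u

Unique-drop-mid : ∀ (xs : List ℕ) y ys → Unique (xs ++ y ∷ ys) → Unique (xs ++ ys)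
Unique-drop-mid [] y ys (_ ∷ u) = u
Unique-drop-mid (x ∷ xs) y ys (x∉ ∷ u) = tabulate (lookup x∉ ∘ widen) ∷ Unique-drop-mid xs y ys u
  where
  widen : ∀ {z} → z ∈ xs ++ ys → z ∈ xs ++ y ∷ ys
  widen z∈ with ∈-++⁻ xs z∈
  ... | inj₁ z∈xs = ∈-++⁺ˡ z∈xs
  ... | inj₂ z∈ys = ∈-++⁺ʳ xs (there z∈ys)

range : ℕ → ℕ → List ℕ
range c zero = []
range c (suc n) = suc c ∷ range (suc c) n

range1≡range : ∀ n → range1 n ≡ range 0 n
range1≡range = map-suc 0
  where
  map-suc : ∀ c n → map suc (applyUpTo (c +_) n) ≡ range c n
  map-suc c zero = refl
  map-suc c (suc n) = cong₂ _∷_ (cong suc (+-identityʳ c)) (begin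
    map suc (applyUpTo (λ i → c + suc i) n) ≡⟨ cong (map suc) (applyUpTo-cong (λ i → +-suc c i) n) ⟩
    map suc (applyUpTo (suc c +_) n)         ≡⟨ map-suc (suc c) n ⟩
    range (suc c) n                           ∎)
    where
    open ≡-Reasoning
    applyUpTo-cong : ∀ {f g : ℕ → ℕ} → (∀ i → f i ≡ g i) → ∀ n → applyUpTo f n ≡ applyUpTo g n
    applyUpTo-cong f≗g zero = refl
    applyUpTo-cong f≗g (suc n) = cong₂ _∷_ (f≗g 0) (applyUpTo-cong (f≗g ∘ suc) n)

length-range : ∀ c n → length (range c n) ≡ n
length-range c zero = refl
length-range c (suc n) = cong suc (length-range (suc c) n)

∈-range⁻ : ∀ {x} c n → x ∈ range c n → suc c ≤ x × x ≤ c + n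
∈-range⁻ c (suc n) (here refl) = ≤-refl , subst (suc c ≤_) (sym (+-suc c n)) (s≤s (m≤m+n c n))
∈-range⁻ {x} c (suc n) (there x∈) with ∈-range⁻ (suc c) n x∈
... | lo , hi = ≤-trans (n≤1+n (suc c)) lo , subst (x ≤_) (sym (+-suc c n)) hi

∈-range⁺ : ∀ {x} c n → suc c ≤ x → x ≤ c + n → x ∈ range c n
∈-range⁺ {x} c zero lo hi = ⊥-elim (<-irrefl refl (≤-trans lo (subst (x ≤_) (+-identityʳ c) hi)))
∈-range⁺ {x} c (suc n) lo hi with suc c ≟ x
... | yes refl = here refl
... | no c+1≢x = there (∈-range⁺ (suc c) n (≤∧≢⇒< lo c+1≢x) (subst (x ≤_) (+-suc c n) hi))

Unique-range : ∀ c n → Unique (range c n)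
Unique-range c zero = []
Unique-range c (suc n) =
  tabulate (λ x∈ c+1≡x → <-irrefl c+1≡x (proj₁ (∈-range⁻ (suc c) n x∈))) ∷ Unique-range (suc c) n

range-snoc : ∀ c n → range c (suc n) ≡ range c n ++ suc (c + n) ∷ []
range-snoc c zero = cong (λ z → suc z ∷ []) (sym (+-identityʳ c))
range-snoc c (suc n) = cong (suc c ∷_) (trans (range-snoc (suc c) n)
  (cong (λ z → range (suc c) n ++ suc z ∷ []) (sym (+-suc c n))))

⊆⇒length≤count : ∀ (P : ℕ → Bool) {xs ys} → xs ⊆ ys → All (λ x → P x ≡ true) xs →
                 length xs ≤ count P ys
⊆⇒length≤count P [] _ = z≤n
⊆⇒length≤count P (y ∷ʳ xs⊆ys) Pxs with P y
... | true = m≤n⇒m≤1+n (⊆⇒length≤count P xs⊆ys Pxs)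
... | false = ⊆⇒length≤count P xs⊆ys Pxs
⊆⇒length≤count P (refl ∷ xs⊆ys) (Px ∷ Pxs) rewrite Px = s≤s (⊆⇒length≤count P xs⊆ys Pxs)

++-∷-⊆⁻ : ∀ xs (c : ℕ) ys {zs} → xs ++ c ∷ ys ⊆ zs →
          Σ (List ℕ) λ P → Σ (List ℕ) λ Q → zs ≡ P ++ c ∷ Q × xs ⊆ P × ys ⊆ Q
++-∷-⊆⁻ [] c ys (z ∷ʳ sub) with ++-∷-⊆⁻ [] c ys sub
... | P , Q , refl , xs⊆P , ys⊆Q = z ∷ P , Q , refl , z ∷ʳ xs⊆P , ys⊆Q
++-∷-⊆⁻ [] c ys (refl ∷ sub) = [] , _ , refl , [] , sub
++-∷-⊆⁻ (x ∷ xs) c ys (z ∷ʳ sub) with ++-∷-⊆⁻ (x ∷ xs) c ys sub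
... | P , Q , refl , xs⊆P , ys⊆Q = z ∷ P , Q , refl , z ∷ʳ xs⊆P , ys⊆Q
++-∷-⊆⁻ (x ∷ xs) c ys (refl ∷ sub) with ++-∷-⊆⁻ xs c ys sub
... | P , Q , refl , xs⊆P , ys⊆Q = x ∷ P , Q , refl , refl ∷ xs⊆P , ys⊆Q

++-∷-cancel : ∀ {c : ℕ} xs ys P Q → c ∉ xs → c ∉ P → xs ++ c ∷ ys ≡ P ++ c ∷ Q → xs ≡ P × ys ≡ Q
++-∷-cancel [] ys [] Q _ _ eq = refl , proj₂ (∷-injective eq)
++-∷-cancel [] ys (p ∷ P) Q _ c∉P eq = ⊥-elim (c∉P (here (proj₁ (∷-injective eq))))
++-∷-cancel (x ∷ xs) ys [] Q c∉xs _ eq = ⊥-elim (c∉xs (here (sym (proj₁ (∷-injective eq)))))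
++-∷-cancel (x ∷ xs) ys (p ∷ P) Q c∉xs c∉P eq with ∷-injective eq
... | refl , eq′ with ++-∷-cancel xs ys P Q (c∉xs ∘ there) (c∉P ∘ there) eq′
...   | refl , refl = refl , refl

∈-drop-++-∷ : ∀ j (P : List ℕ) c Q → j ≤ length P → c ∈ drop j (P ++ c ∷ Q)
∈-drop-++-∷ zero [] c Q _ = here refl
∈-drop-++-∷ zero (p ∷ P) c Q _ = there (∈-drop-++-∷ zero P c Q z≤n)
∈-drop-++-∷ (suc j) (p ∷ P) c Q (s≤s j≤) = ∈-drop-++-∷ j P c Q j≤

take-++-∷ : ∀ j (P : List ℕ) c Q → length P < j → take j (P ++ c ∷ Q) ≡ P ++ c ∷ take (j ∸ suc (length P)) Q
take-++-∷ (suc j) [] c Q _ = refl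
take-++-∷ (suc j) (p ∷ P) c Q (s≤s P<j) = cong (p ∷_) (take-++-∷ j P c Q P<j)

count-take≤ : ∀ (P : ℕ → Bool) j xs → count P (take j xs) ≤ count P xs
count-take≤ P j xs = begin
  count P (take j xs)                           ≤⟨ m≤m+n _ _ ⟩
  count P (take j xs) + count P (drop j xs)     ≡⟨ count-++ P (take j xs) (drop j xs) ⟨
  count P (take j xs ++ drop j xs)              ≡⟨ cong (count P) (take++drop≡id j xs) ⟩
  count P xs                                    ∎
  where open ≤-Reasoning

∈-take⁻ : ∀ {x : ℕ} j xs → x ∈ take j xs → x ∈ xs
∈-take⁻ {x} j xs x∈ = subst (x ∈_) (take++drop≡id j xs) (∈-++⁺ˡ x∈)

-- Inversions and adjacent transpositions

countPairs : (ℕ → ℕ → Bool) → List ℕ → ℕ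
countPairs R [] = 0
countPairs R (x ∷ xs) = count (R x) xs + countPairs R xs

inversions : List ℕ → ℕ
inversions = countPairs λ x y → y <ᵇ x

count-swap : ∀ (P : ℕ → Bool) xs x y ys → count P (xs ++ y ∷ x ∷ ys) ≡ count P (xs ++ x ∷ y ∷ ys)
count-swap P [] x y ys with P x | P y
... | true  | true  = refl
... | true  | false = refl
... | false | true  = refl
... | false | false = refl
count-swap P (z ∷ xs) x y ys with P z
... | true = cong suc (count-swap P xs x y ys)
... | false = count-swap P xs x y ys

inversions-swap-ascent : ∀ xs {x y} ys → x < y →
                         inversions (xs ++ y ∷ x ∷ ys) ≡ suc (inversions (xs ++ x ∷ y ∷ ys))
inversions-swap-ascent [] {x} {y} ys x<y
  rewrite <⇒<ᵇ≡true x<y | ≥⇒<ᵇ≡false (<⇒≤ x<y) =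
  solve 3 (λ a b c → (con 1 :+ a) :+ (b :+ c) := con 1 :+ (b :+ (a :+ c))) refl
    (count (_<ᵇ y) ys) (count (_<ᵇ x) ys) (inversions ys)
inversions-swap-ascent (z ∷ xs) {x} {y} ys x<y = begin
  count (_<ᵇ z) (xs ++ y ∷ x ∷ ys) + inversions (xs ++ y ∷ x ∷ ys)
    ≡⟨ cong₂ _+_ (count-swap (_<ᵇ z) xs x y ys) (inversions-swap-ascent xs ys x<y) ⟩
  count (_<ᵇ z) (xs ++ x ∷ y ∷ ys) + suc (inversions (xs ++ x ∷ y ∷ ys))
    ≡⟨ +-suc _ _ ⟩
  suc (count (_<ᵇ z) (xs ++ x ∷ y ∷ ys) + inversions (xs ++ x ∷ y ∷ ys)) ∎
  where open ≡-Reasoning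

inversions≡0⇒≡range : ∀ c n v → inversions v ≡ 0 → v ↭ range c n → v ≡ range c n
inversions≡0⇒≡range c zero v _ v↭ = ↭-empty-inv v↭
inversions≡0⇒≡range c (suc n) [] _ v↭ with ↭-length v↭
... | ()
inversions≡0⇒≡range c (suc n) (x ∷ v) inv≡0 v↭ = cong₂ _∷_ x≡c+1
  (inversions≡0⇒≡range (suc c) n v (m+n≡0⇒n≡0 (count (_<ᵇ x) v) inv≡0)
    (drop-∷ (subst (λ z → z ∷ v ↭ range c (suc n)) x≡c+1 v↭)))
  where
  x≡c+1 : x ≡ suc c
  x≡c+1 with ∈-resp-↭ (↭-sym v↭) (here refl)
  ... | here c+1≡x = sym c+1≡x
  ... | there c+1∈v = ≤-antisym
    (<ᵇ≡false⇒≥ {suc c} {x} (count≡0⇒∀ (_<ᵇ x) v (m+n≡0⇒m≡0 _ inv≡0) c+1∈v))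
    (proj₁ (∈-range⁻ c (suc n) (∈-resp-↭ v↭ (here refl))))

inversions-range : ∀ c n → inversions (range c n) ≡ 0
inversions-range c zero = refl
inversions-range c (suc n) = cong₂ _+_
  (∀⇒count≡0 (_<ᵇ suc c) (range (suc c) n)
    (λ {x} x∈ → ≥⇒<ᵇ≡false (≤-trans (n≤1+n _) (proj₁ (∈-range⁻ (suc c) n x∈)))))
  (inversions-range (suc c) n)

swapPos-at : ∀ xs (x y : ℕ) ys → swapPos (xs ++ x ∷ y ∷ ys) (suc (length xs)) ≡ xs ++ y ∷ x ∷ ys
swapPos-at [] x y ys = refl
swapPos-at (z ∷ []) x y ys = refl
swapPos-at (z ∷ z′ ∷ xs) x y ys = cong (z ∷_) (swapPos-at (z′ ∷ xs) x y ys)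

swapPos-cases : ∀ v a → swapPos v a ≡ v ⊎
  Σ (List ℕ) λ P → Σ ℕ λ x → Σ ℕ λ y → Σ (List ℕ) λ Q → v ≡ P ++ x ∷ y ∷ Q × a ≡ suc (length P)
swapPos-cases [] a = inj₁ refl
swapPos-cases (x ∷ []) zero = inj₁ refl
swapPos-cases (x ∷ []) (suc zero) = inj₁ refl
swapPos-cases (x ∷ []) (suc (suc a)) = inj₁ refl
swapPos-cases (x ∷ y ∷ v) zero = inj₁ refl
swapPos-cases (x ∷ y ∷ v) (suc zero) = inj₂ ([] , x , y , v , refl , refl)
swapPos-cases (x ∷ y ∷ v) (suc (suc a)) with swapPos-cases (y ∷ v) (suc a)
... | inj₁ eq = inj₁ (cong (x ∷_) eq)
... | inj₂ (P , x′ , y′ , Q , eq , refl) = inj₂ (x ∷ P , x′ , y′ , Q , cong (x ∷_) eq , refl)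

inversions-swapPos≤ : ∀ v a → inversions (swapPos v a) ≤ suc (inversions v)
inversions-swapPos≤ v a with swapPos-cases v a
... | inj₁ eq rewrite eq = n≤1+n _
... | inj₂ (P , x , y , Q , refl , refl) rewrite swapPos-at P x y Q with <-cmp x y
...   | tri< x<y _ _ = ≤-reflexive (inversions-swap-ascent P Q x<y)
...   | tri≈ _ refl _ = n≤1+n _
...   | tri> _ _ y<x rewrite inversions-swap-ascent P Q y<x = ≤-trans (n≤1+n _) (n≤1+n _)

swapPos-ascent : ∀ v a → inversions (swapPos v a) ≡ suc (inversions v) →
  Σ (List ℕ) λ P → Σ ℕ λ x → Σ ℕ λ y → Σ (List ℕ) λ Q →
    v ≡ P ++ x ∷ y ∷ Q × a ≡ suc (length P) × x < y
swapPos-ascent v a grows with swapPos-cases v a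
... | inj₁ eq rewrite eq = ⊥-elim (1+n≢n (sym grows))
... | inj₂ (P , x , y , Q , refl , refl) rewrite swapPos-at P x y Q with <-cmp x y
...   | tri< x<y _ _ = P , x , y , Q , refl , refl , x<y
...   | tri≈ _ refl _ = ⊥-elim (1+n≢n (sym grows))
...   | tri> _ _ y<x rewrite inversions-swap-ascent P Q y<x =
  ⊥-elim (1+n≰n (≤-trans (n≤1+n _) (≤-reflexive (sym grows))))

inversions-foldl-swapPos≤ : ∀ v ws → inversions (foldl swapPos v ws) ≤ length ws + inversions v
inversions-foldl-swapPos≤ v [] = ≤-refl
inversions-foldl-swapPos≤ v (a ∷ ws) = begin
  inversions (foldl swapPos (swapPos v a) ws) ≤⟨ inversions-foldl-swapPos≤ (swapPos v a) ws ⟩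
  length ws + inversions (swapPos v a)        ≤⟨ +-monoʳ-≤ (length ws) (inversions-swapPos≤ v a) ⟩
  length ws + suc (inversions v)               ≡⟨ +-suc (length ws) (inversions v) ⟩
  suc (length ws + inversions v)               ∎
  where open ≤-Reasoning

adjacent-descent : ∀ v {m} → inversions v ≡ suc m →
  Σ (List ℕ) λ P → Σ ℕ λ x → Σ ℕ λ y → Σ (List ℕ) λ Q → v ≡ P ++ x ∷ y ∷ Q × y < x
adjacent-descent (x ∷ v) inv≡ with inversions v in inv-v
... | suc _ with adjacent-descent v inv-v
...   | P , a , b , Q , refl , b<a = x ∷ P , a , b , Q , refl , b<a
adjacent-descent (x ∷ []) () | zero
adjacent-descent (x ∷ y ∷ v) inv≡ | zero with y <ᵇ x in y<ᵇx
... | true = [] , x , y , v , refl , <ᵇ≡true⇒< y<ᵇx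
... | false = ⊥-elim (0≢1+n (trans (sym no-smaller) (trans (sym (+-identityʳ _)) inv≡)))
  where
  -- x ≤ y, so everything below x in v lies below y, and there is nothing below y
  no-smaller : count (_<ᵇ x) v ≡ 0
  no-smaller = n≤0⇒n≡0 (≤-trans
    (count-mono (_<ᵇ x) (_<ᵇ y)
      (λ z z<ᵇx → <⇒<ᵇ≡true (<-≤-trans (<ᵇ≡true⇒< z<ᵇx) (<ᵇ≡false⇒≥ {y} {x} y<ᵇx))) v)
    (≤-reflexive (m+n≡0⇒m≡0 _ inv-v)))

bubble-sort : ∀ n v → v ↭ range 0 n →
  Σ (List ℕ) λ ws → IsWord n ws × foldl swapPos (range 0 n) ws ≡ v × length ws ≡ inversions v
bubble-sort n v v↭ = sort (inversions v) v refl v↭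
  where
  sort : ∀ m v → inversions v ≡ m → v ↭ range 0 n →
    Σ (List ℕ) λ ws → IsWord n ws × foldl swapPos (range 0 n) ws ≡ v × length ws ≡ m
  sort zero v inv≡0 v↭ = [] , [] , sym (inversions≡0⇒≡range 0 n v inv≡0 v↭) , refl
  sort (suc m) v inv≡ v↭ with adjacent-descent v inv≡
  ... | P , x , y , Q , refl , y<x
    with sort m (P ++ y ∷ x ∷ Q)
      (suc-injective (trans (sym (inversions-swap-ascent P Q y<x)) inv≡))
      (↭-trans (++⁺ˡ P (↭-swap y x ↭-refl)) v↭)
  ... | ws , ws-word , ws-sorts , ws-length =
    ws ++ suc (length P) ∷ [] , ++⁺ ws-word ((s≤s z≤n , in-bounds) ∷ []) , sorts , length-snoc
    where
    in-bounds : suc (suc (length P)) ≤ n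
    in-bounds = begin
      suc (suc (length P))         ≤⟨ s≤s (s≤s (m≤m+n (length P) (length Q))) ⟩
      suc (suc (length P + length Q)) ≡⟨ cong suc (+-suc (length P) (length Q)) ⟨
      suc (length P + length (y ∷ Q)) ≡⟨ +-suc (length P) (suc (length Q)) ⟨
      length P + length (x ∷ y ∷ Q) ≡⟨ length-++ P ⟨
      length (P ++ x ∷ y ∷ Q)      ≡⟨ ↭-length v↭ ⟩
      length (range 0 n)           ≡⟨ length-range 0 n ⟩
      n                            ∎
      where open ≤-Reasoning
    sorts : foldl swapPos (range 0 n) (ws ++ suc (length P) ∷ []) ≡ P ++ x ∷ y ∷ Q
    sorts = trans (foldl-++ swapPos (range 0 n) ws _)
      (trans (cong (λ u → swapPos u (suc (length P))) ws-sorts) (swapPos-at P y x Q))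
    length-snoc : length (ws ++ suc (length P) ∷ []) ≡ suc m
    length-snoc = trans (length-++ ws) (trans (cong (_+ 1) ws-length) (+-comm m 1))

reduced-word-length : ∀ n u ws → u ↭ range1 n → IsReduced n u ws → length ws ≡ inversions u
reduced-word-length n u ws u↭ (ws-word , ws-spells , ws-minimal) = ≤-antisym shortest longest
  where
  u↭′ : u ↭ range 0 n
  u↭′ = subst (u ↭_) (range1≡range n) u↭
  shortest : length ws ≤ inversions u
  shortest with bubble-sort n u u↭′
  ... | vs , vs-word , vs-spells , vs-length = subst (length ws ≤_) vs-length
    (ws-minimal vs vs-word (trans (cong (λ r → foldl swapPos r vs) (range1≡range n)) vs-spells))
  longest : inversions u ≤ length ws
  longest = begin
    inversions u                                 ≡⟨ cong inversions ws-spells ⟨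
    inversions (foldl swapPos (range1 n) ws)     ≤⟨ inversions-foldl-swapPos≤ (range1 n) ws ⟩
    length ws + inversions (range1 n)            ≡⟨ cong (λ r → length ws + inversions r) (range1≡range n) ⟩
    length ws + inversions (range 0 n)           ≡⟨ cong (length ws +_) (inversions-range 0 n) ⟩
    length ws + 0                                ≡⟨ +-identityʳ (length ws) ⟩
    length ws                                    ∎
    where open ≤-Reasoning

-- Inversions across a cut, and the support of a permutation

crossInversions : List ℕ → List ℕ → ℕ
crossInversions [] ys = 0
crossInversions (x ∷ xs) ys = count (_<ᵇ x) ys + crossInversions xs ys

splitInversions : ℕ → List ℕ → ℕ
splitInversions k v = crossInversions (take k v) (drop k v)

count<-drop-swap-ascent : ∀ j z xs {x y} ys → x < y →
  count (_<ᵇ z) (drop j (xs ++ x ∷ y ∷ ys)) ≤ count (_<ᵇ z) (drop j (xs ++ y ∷ x ∷ ys))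
count<-drop-swap-ascent zero z xs {x} {y} ys x<y = ≤-reflexive (sym (count-swap (_<ᵇ z) xs x y ys))
count<-drop-swap-ascent (suc zero) z [] {x} {y} ys x<y with y <ᵇ z in y<ᵇz | x <ᵇ z in x<ᵇz
... | true  | true  = ≤-refl
... | true  | false = ⊥-elim (<⇒≱ (<-trans x<y (<ᵇ≡true⇒< y<ᵇz)) (<ᵇ≡false⇒≥ {x} {z} x<ᵇz))
... | false | true  = n≤1+n _
... | false | false = ≤-refl
count<-drop-swap-ascent (suc (suc j)) z [] ys x<y = ≤-refl
count<-drop-swap-ascent (suc j) z (_ ∷ xs) ys x<y = count<-drop-swap-ascent j z xs ys x<y

splitInversions-swap-ascent : ∀ k xs {x y} ys → x < y →
  splitInversions k (xs ++ x ∷ y ∷ ys) ≤ splitInversions k (xs ++ y ∷ x ∷ ys)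
splitInversions-swap-ascent zero xs ys x<y = z≤n
splitInversions-swap-ascent (suc zero) [] {x} {y} ys x<y
  rewrite <⇒<ᵇ≡true x<y | ≥⇒<ᵇ≡false (<⇒≤ x<y) =
  +-monoˡ-≤ 0 (m≤n⇒m≤1+n (count-mono (_<ᵇ x) (_<ᵇ y)
    (λ z z<ᵇx → <⇒<ᵇ≡true (<-trans (<ᵇ≡true⇒< z<ᵇx) x<y)) ys))
splitInversions-swap-ascent (suc (suc k)) [] {x} {y} ys x<y = ≤-reflexive
  (solve 3 (λ a b c → a :+ (b :+ c) := b :+ (a :+ c)) refl
    (count (_<ᵇ x) (drop k ys)) (count (_<ᵇ y) (drop k ys)) (splitInversions k ys))
splitInversions-swap-ascent (suc k) (z ∷ xs) ys x<y =
  +-mono-≤ (count<-drop-swap-ascent k z xs ys x<y) (splitInversions-swap-ascent k xs ys x<y)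

splitInversions-swap-ascent-at : ∀ xs {x y} ys → x < y →
  splitInversions (suc (length xs)) (xs ++ x ∷ y ∷ ys) <
  splitInversions (suc (length xs)) (xs ++ y ∷ x ∷ ys)
splitInversions-swap-ascent-at [] {x} {y} ys x<y
  rewrite <⇒<ᵇ≡true x<y | ≥⇒<ᵇ≡false (<⇒≤ x<y) =
  s≤s (+-monoˡ-≤ 0 (count-mono (_<ᵇ x) (_<ᵇ y)
    (λ z z<ᵇx → <⇒<ᵇ≡true (<-trans (<ᵇ≡true⇒< z<ᵇx) x<y)) ys))
splitInversions-swap-ascent-at (z ∷ xs) ys x<y =
  +-mono-≤-< (count<-drop-swap-ascent (suc (length xs)) z xs ys x<y)
             (splitInversions-swap-ascent-at xs ys x<y)

splitInversions-swapPos : ∀ k v a ws → inversions (swapPos v a) ≡ suc (inversions v) →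
  splitInversions k v + count (k ≡ᵇ_) (a ∷ ws) ≤ splitInversions k (swapPos v a) + count (k ≡ᵇ_) ws
splitInversions-swapPos k v a ws grows with swapPos-ascent v a grows
... | P , x , y , Q , refl , refl , x<y rewrite swapPos-at P x y Q with k ≡ᵇ suc (length P) in k≡ᵇa
...   | true rewrite ≡ᵇ≡true⇒≡ {k} k≡ᵇa =
  ≤-trans (≤-reflexive (+-suc _ _))
          (+-monoˡ-≤ (count (suc (length P) ≡ᵇ_) ws) (splitInversions-swap-ascent-at P Q x<y))
...   | false = +-monoˡ-≤ (count (k ≡ᵇ_) ws) (splitInversions-swap-ascent k P Q x<y)

-- Along a word each of whose letters adds an inversion, every occurrence of k adds a split inversion at k.
splitInversions-foldl-swapPos : ∀ k v ws → inversions (foldl swapPos v ws) ≡ length ws + inversions v →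
  splitInversions k v + count (k ≡ᵇ_) ws ≤ splitInversions k (foldl swapPos v ws)
splitInversions-foldl-swapPos k v [] _ = ≤-reflexive (+-identityʳ _)
splitInversions-foldl-swapPos k v (a ∷ ws) tight = begin
  splitInversions k v + count (k ≡ᵇ_) (a ∷ ws)      ≤⟨ splitInversions-swapPos k v a ws grows ⟩
  splitInversions k v′ + count (k ≡ᵇ_) ws            ≤⟨ splitInversions-foldl-swapPos k v′ ws rest-tight ⟩
  splitInversions k (foldl swapPos v′ ws)            ∎
  where
  open ≤-Reasoning
  v′ = swapPos v a
  grows : inversions v′ ≡ suc (inversions v)
  grows = ≤-antisym (inversions-swapPos≤ v a) (+-cancelˡ-≤ (length ws) _ _ (begin
    length ws + suc (inversions v)     ≡⟨ +-suc (length ws) (inversions v) ⟩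
    suc (length ws + inversions v)     ≡⟨ tight ⟨
    inversions (foldl swapPos v′ ws)   ≤⟨ inversions-foldl-swapPos≤ v′ ws ⟩
    length ws + inversions v′          ∎))
  rest-tight : inversions (foldl swapPos v′ ws) ≡ length ws + inversions v′
  rest-tight = trans tight
    (trans (sym (+-suc (length ws) (inversions v))) (cong (length ws +_) (sym grows)))

reduced-word-splitInversions : ∀ n u ws k → u ↭ range1 n → IsReduced n u ws → k ∈ ws →
                               1 ≤ splitInversions k u
reduced-word-splitInversions n u ws k u↭ reduced@(_ , ws-spells , _) k∈ws = begin
  1                                            ≤⟨ ∃⇒count≥1 (k ≡ᵇ_) k∈ws (≡ᵇ-refl k) ⟩
  count (k ≡ᵇ_) ws                             ≤⟨ m≤n+m _ _ ⟩
  splitInversions k (range1 n) + count (k ≡ᵇ_) ws ≤⟨ splitInversions-foldl-swapPos k (range1 n) ws tight ⟩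
  splitInversions k (foldl swapPos (range1 n) ws) ≡⟨ cong (splitInversions k) ws-spells ⟩
  splitInversions k u                          ∎
  where
  open ≤-Reasoning
  tight : inversions (foldl swapPos (range1 n) ws) ≡ length ws + inversions (range1 n)
  tight = begin-equality
    inversions (foldl swapPos (range1 n) ws) ≡⟨ cong inversions ws-spells ⟩
    inversions u                              ≡⟨ reduced-word-length n u ws u↭ reduced ⟨
    length ws                                 ≡⟨ +-identityʳ (length ws) ⟨
    length ws + 0                             ≡⟨ cong (length ws +_) (inversions-range 0 n) ⟨
    length ws + inversions (range 0 n)        ≡⟨ cong (λ r → length ws + inversions r) (range1≡range n) ⟨
    length ws + inversions (range1 n)         ∎

crossInversions≥1⇒∃ : ∀ xs ys → 1 ≤ crossInversions xs ys →
  Σ ℕ λ l → Σ ℕ λ r → l ∈ xs × r ∈ ys × r < l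
crossInversions≥1⇒∃ (l ∷ xs) ys h with count (_<ᵇ l) ys in count≡
... | zero with crossInversions≥1⇒∃ xs ys h
...   | l′ , r , l′∈ , r∈ , r<l′ = l′ , r , there l′∈ , r∈ , r<l′
crossInversions≥1⇒∃ (l ∷ xs) ys h | suc _
  with count≥1⇒∃ (_<ᵇ l) ys (≤-trans (s≤s z≤n) (≤-reflexive (sym count≡)))
... | r , r∈ , r<ᵇl = l , r , here refl , r∈ , <ᵇ≡true⇒< r<ᵇl

-- If nothing at most k lay beyond position k, then take k u would contain 1, …, k and also l > k.
crossInversion⇒small-after : ∀ n u k → u ↭ range 0 n → k ≤ n → ∀ {l r} →
  l ∈ take k u → r ∈ drop k u → r < l → Σ ℕ λ y → y ∈ drop k u × y ≤ k
crossInversion⇒small-after n u k u↭ k≤n {l} {r} l∈ r∈ r<l with count (_≤ᵇ k) (drop k u) in count≡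
... | suc _ with count≥1⇒∃ (_≤ᵇ k) (drop k u) (≤-trans (s≤s z≤n) (≤-reflexive (sym count≡)))
...   | y , y∈ , y≤ᵇk = y , y∈ , ≤ᵇ≡true⇒≤ y≤ᵇk
crossInversion⇒small-after n u k u↭ k≤n {l} {r} l∈ r∈ r<l | zero =
  ⊥-elim (1+n≰n (begin
    suc k                  ≡⟨ cong suc (length-range 0 k) ⟨
    length (l ∷ range 0 k) ≤⟨ Unique⇒length≤ distinct ⊆take ⟩
    length (take k u)      ≡⟨ length-take k u ⟩
    k ⊓ length u           ≤⟨ m⊓n≤m k _ ⟩
    k                      ∎))
  where
  open ≤-Reasoning
  large-after : ∀ {y} → y ∈ drop k u → k < y
  large-after y∈ = ≤ᵇ≡false⇒> (count≡0⇒∀ (_≤ᵇ k) (drop k u) count≡ y∈)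
  k<l : k < l
  k<l = <-trans (large-after r∈) r<l
  distinct : Unique (l ∷ range 0 k)
  distinct = tabulate (λ y∈ l≡y → 1+n≰n (≤-trans k<l (subst (_≤ k) (sym l≡y) (proj₂ (∈-range⁻ 0 k y∈)))))
           ∷ Unique-range 0 k
  ⊆take : ∀ {y} → y ∈ l ∷ range 0 k → y ∈ take k u
  ⊆take (here refl) = l∈
  ⊆take {y} (there y∈) with ∈-range⁻ 0 k y∈
  ... | 1≤y , y≤k with ∈-++⁻ (take k u) (subst (y ∈_) (sym (take++drop≡id k u))
                         (∈-resp-↭ (↭-sym u↭) (∈-range⁺ 0 n 1≤y (≤-trans y≤k k≤n))))
  ...   | inj₁ y∈take = y∈take
  ...   | inj₂ y∈drop = ⊥-elim (1+n≰n (≤-trans (large-after y∈drop) y≤k))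

InSupp⇒small-after : ∀ n u k → u ↭ range1 n → InSupp n u k →
  1 ≤ k × suc k ≤ n × Σ ℕ λ y → y ∈ drop k u × y ≤ k
InSupp⇒small-after n u k u↭ (ws , reduced , k∈ws) with lookup (proj₁ reduced) k∈ws
... | 1≤k , k<n
  with crossInversions≥1⇒∃ (take k u) (drop k u) (reduced-word-splitInversions n u ws k u↭ reduced k∈ws)
...   | l , r , l∈ , r∈ , r<l = 1≤k , k<n ,
  crossInversion⇒small-after n u k (subst (u ↭_) (range1≡range n) u↭) (≤-trans (n≤1+n k) k<n) l∈ r∈ r<l

-- Occurrences of 321 and 3412 through the letter N

above below : ℕ → List ℕ → ℕ
above z xs = count (z <ᵇ_) xs
below z xs = count (_<ᵇ z) xs

ascentsUnder : ℕ → List ℕ → ℕ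
ascentsUnder a = countPairs λ x y → (x <ᵇ y) ∧ (y <ᵇ a)

-- With w = A ++ N ∷ B, each inversion of B gives an N-occurrence N y x of 321, and each
-- a ∈ A with an ascent x < y < a of B gives an N-occurrence a N x y of 3412.
occurrenceBound : List ℕ → List ℕ → ℕ
occurrenceBound A B = inversions B + sum (map (λ a → ascentsUnder a B) A)

IsNOcc : ℕ → List ℕ → List ℕ → Bool
IsNOcc N p s = (std s ==ᴸ p) ∧ (maxL s ≡ᵇ N)

extensions : (List ℕ → Bool) → List ℕ → List ℕ → ℕ
extensions P pre xs = count (λ s → P (pre ++ s)) (subseqs xs)

nOcc≡extensions : ∀ N p w → nOcc N p w ≡ extensions (IsNOcc N p) [] w
nOcc≡extensions N p w = length-filterᵇ _ (subseqs w)

extensions-∷ : ∀ P pre x xs →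
  extensions P pre (x ∷ xs) ≡ extensions P (pre ++ x ∷ []) xs + extensions P pre xs
extensions-∷ P pre x xs = begin
  count (λ s → P (pre ++ s)) (map (x ∷_) (subseqs xs) ++ subseqs xs)
    ≡⟨ count-++ (λ s → P (pre ++ s)) (map (x ∷_) (subseqs xs)) (subseqs xs) ⟩
  count (λ s → P (pre ++ s)) (map (x ∷_) (subseqs xs)) + extensions P pre xs
    ≡⟨ cong (_+ extensions P pre xs) (count-map (λ s → P (pre ++ s)) (x ∷_) (subseqs xs)) ⟩
  count (λ s → P (pre ++ x ∷ s)) (subseqs xs) + extensions P pre xs
    ≡⟨ cong (_+ extensions P pre xs)
         (count-cong _ _ (λ s → cong P (sym (++-assoc pre (x ∷ []) s))) (subseqs xs)) ⟩
  extensions P (pre ++ x ∷ []) xs + extensions P pre xs ∎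
  where open ≡-Reasoning

extensions-skip : ∀ P pre x xs → extensions P pre xs ≤ extensions P pre (x ∷ xs)
extensions-skip P pre x xs = subst (extensions P pre xs ≤_) (sym (extensions-∷ P pre x xs)) (m≤n+m _ _)

extensions-take : ∀ P pre x xs → extensions P (pre ++ x ∷ []) xs ≤ extensions P pre (x ∷ xs)
extensions-take P pre x xs =
  subst (extensions P (pre ++ x ∷ []) xs ≤_) (sym (extensions-∷ P pre x xs)) (m≤m+n _ _)

extensions-skip-++ : ∀ P pre ys xs → extensions P pre xs ≤ extensions P pre (ys ++ xs)
extensions-skip-++ P pre [] xs = ≤-refl
extensions-skip-++ P pre (y ∷ ys) xs =
  ≤-trans (extensions-skip-++ P pre ys xs) (extensions-skip P pre y (ys ++ xs))

extensions≥1 : ∀ P pre xs → P pre ≡ true → 1 ≤ extensions P pre xs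
extensions≥1 P pre [] P-pre rewrite ++-identityʳ pre | P-pre = ≤-refl
extensions≥1 P pre (x ∷ xs) P-pre = ≤-trans (extensions≥1 P pre xs P-pre) (extensions-skip P pre x xs)

extensions-heads : ∀ P pre As ys →
  sum (map (λ a → extensions P (pre ++ a ∷ []) ys) As) ≤ extensions P pre (As ++ ys)
extensions-heads P pre [] ys = z≤n
extensions-heads P pre (a ∷ As) ys =
  subst (sum (map (λ a → extensions P (pre ++ a ∷ []) ys) (a ∷ As)) ≤_)
        (sym (extensions-∷ P pre a (As ++ ys)))
  (+-mono-≤ (extensions-skip-++ P (pre ++ a ∷ []) As ys) (extensions-heads P pre As ys))

extensions≥1⇒∃ : ∀ P pre xs → 1 ≤ extensions P pre xs → Σ (List ℕ) λ s → s ⊆ xs × P (pre ++ s) ≡ true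
extensions≥1⇒∃ P pre [] h with P (pre ++ []) in P-pre
... | true = [] , [] , P-pre
... | false = ⊥-elim (1+n≰n h)
extensions≥1⇒∃ P pre (x ∷ xs) h
  with extensions P (pre ++ x ∷ []) xs in taken | subst (1 ≤_) (extensions-∷ P pre x xs) h
... | zero | h′ with extensions≥1⇒∃ P pre xs h′
...   | s , s⊆ , Ps = s , x ∷ʳ s⊆ , Ps
extensions≥1⇒∃ P pre (x ∷ xs) h | suc _ | _
  with extensions≥1⇒∃ P (pre ++ x ∷ []) xs (≤-trans (s≤s z≤n) (≤-reflexive (sym taken)))
... | s , s⊆ , Ps = x ∷ s , refl ∷ s⊆ , subst (λ t → P t ≡ true) (++-assoc pre (x ∷ []) s) Ps

count≤extensions : ∀ P pre Q xs → (∀ y → Q y ≡ true → P (pre ++ y ∷ []) ≡ true) →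
                   count Q xs ≤ extensions P pre xs
count≤extensions P pre Q [] _ = z≤n
count≤extensions P pre Q (y ∷ ys) Q⇒P with Q y in Qy
... | true = subst (suc (count Q ys) ≤_) (sym (extensions-∷ P pre y ys))
  (+-mono-≤ (extensions≥1 P (pre ++ y ∷ []) ys (Q⇒P y Qy)) (count≤extensions P pre Q ys Q⇒P))
... | false = ≤-trans (count≤extensions P pre Q ys Q⇒P) (extensions-skip P pre y ys)

countPairs≤extensions : ∀ P pre R xs →
  All (λ x → ∀ y → R x y ≡ true → P (pre ++ x ∷ y ∷ []) ≡ true) xs →
  countPairs R xs ≤ extensions P pre xs
countPairs≤extensions P pre R [] _ = z≤n
countPairs≤extensions P pre R (x ∷ xs) (R⇒P ∷ Rs⇒P) =
  subst (countPairs R (x ∷ xs) ≤_) (sym (extensions-∷ P pre x xs))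
    (+-mono-≤ (count≤extensions P (pre ++ x ∷ []) (R x) xs
                (λ y Rxy → subst (λ t → P t ≡ true) (sym (++-assoc pre (x ∷ []) (y ∷ []))) (R⇒P y Rxy)))
              (countPairs≤extensions P pre R xs Rs⇒P))

rank : List ℕ → ℕ → ℕ
rank s x = suc (count (_<ᵇ x) s)

std≡map-rank : ∀ s → std s ≡ map (rank s) s
std≡map-rank s = map-cong (λ x → cong suc (length-filterᵇ (_<ᵇ x) s)) s

==ᴸ-refl : ∀ xs → (xs ==ᴸ xs) ≡ true
==ᴸ-refl [] = refl
==ᴸ-refl (x ∷ xs) rewrite ≡ᵇ-refl x = ==ᴸ-refl xs

==ᴸ≡true⇒≡ : ∀ xs ys → (xs ==ᴸ ys) ≡ true → xs ≡ ys
==ᴸ≡true⇒≡ [] [] _ = refl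
==ᴸ≡true⇒≡ (x ∷ xs) (y ∷ ys) eq =
  cong₂ _∷_ (≡ᵇ≡true⇒≡ (∧≡true⇒ˡ eq)) (==ᴸ≡true⇒≡ xs ys (∧≡true⇒ʳ {x ≡ᵇ y} eq))

IsNOcc-intro : ∀ N p s → std s ≡ p → maxL s ≡ N → IsNOcc N p s ≡ true
IsNOcc-intro N p s refl refl = ∧≡true (==ᴸ-refl (std s)) (≡ᵇ-refl (maxL s))

<ᵇ-irrefl : ∀ n → (n <ᵇ n) ≡ false
<ᵇ-irrefl n = ≥⇒<ᵇ≡false {n} {n} ≤-refl

321-occurrence : ∀ N x y → y < x → x < N → IsNOcc N (3 ∷ 2 ∷ 1 ∷ []) (N ∷ x ∷ y ∷ []) ≡ true
321-occurrence N x y y<x x<N =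
  IsNOcc-intro N (3 ∷ 2 ∷ 1 ∷ []) (N ∷ x ∷ y ∷ []) (trans (std≡map-rank (N ∷ x ∷ y ∷ [])) ranks) maximum
  where
  y<N = <-trans y<x x<N
  ranks : map (λ z → suc (count (_<ᵇ z) (N ∷ x ∷ y ∷ []))) (N ∷ x ∷ y ∷ []) ≡ 3 ∷ 2 ∷ 1 ∷ []
  ranks rewrite <ᵇ-irrefl N | <ᵇ-irrefl x | <ᵇ-irrefl y
    | <⇒<ᵇ≡true y<x | <⇒<ᵇ≡true x<N | <⇒<ᵇ≡true y<N
    | ≥⇒<ᵇ≡false {x} {y} (<⇒≤ y<x) | ≥⇒<ᵇ≡false {N} {x} (<⇒≤ x<N) | ≥⇒<ᵇ≡false {N} {y} (<⇒≤ y<N) = refl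
  maximum : maxL (N ∷ x ∷ y ∷ []) ≡ N
  maximum rewrite ⊔-identityʳ y | m≥n⇒m⊔n≡m (<⇒≤ y<x) | m≥n⇒m⊔n≡m (<⇒≤ x<N) = refl

3412-occurrence : ∀ N a x y → x < y → y < a → a < N →
                  IsNOcc N (3 ∷ 4 ∷ 1 ∷ 2 ∷ []) (a ∷ N ∷ x ∷ y ∷ []) ≡ true
3412-occurrence N a x y x<y y<a a<N =
  IsNOcc-intro N (3 ∷ 4 ∷ 1 ∷ 2 ∷ []) (a ∷ N ∷ x ∷ y ∷ [])
    (trans (std≡map-rank (a ∷ N ∷ x ∷ y ∷ [])) ranks) maximum
  where
  x<a = <-trans x<y y<a
  y<N = <-trans y<a a<N
  x<N = <-trans x<a a<N
  ranks : map (λ z → suc (count (_<ᵇ z) (a ∷ N ∷ x ∷ y ∷ []))) (a ∷ N ∷ x ∷ y ∷ []) ≡ 3 ∷ 4 ∷ 1 ∷ 2 ∷ []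
  ranks rewrite <ᵇ-irrefl N | <ᵇ-irrefl x | <ᵇ-irrefl y | <ᵇ-irrefl a
    | <⇒<ᵇ≡true x<y | <⇒<ᵇ≡true y<a | <⇒<ᵇ≡true a<N | <⇒<ᵇ≡true x<a | <⇒<ᵇ≡true y<N | <⇒<ᵇ≡true x<N
    | ≥⇒<ᵇ≡false {y} {x} (<⇒≤ x<y) | ≥⇒<ᵇ≡false {a} {y} (<⇒≤ y<a) | ≥⇒<ᵇ≡false {N} {a} (<⇒≤ a<N)
    | ≥⇒<ᵇ≡false {a} {x} (<⇒≤ x<a) | ≥⇒<ᵇ≡false {N} {y} (<⇒≤ y<N) | ≥⇒<ᵇ≡false {N} {x} (<⇒≤ x<N) = refl
  maximum : maxL (a ∷ N ∷ x ∷ y ∷ []) ≡ N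
  maximum rewrite ⊔-identityʳ y | m≤n⇒m⊔n≡n (<⇒≤ x<y) | m≥n⇒m⊔n≡m (<⇒≤ y<N) | m≤n⇒m⊔n≡n (<⇒≤ a<N) = refl

occurrenceBound≤count321-3412 : ∀ N A B → All (_< N) A → All (_< N) B →
  occurrenceBound A B ≤ count321-3412 N (A ++ N ∷ B)
occurrenceBound≤count321-3412 N A B A<N B<N =
  subst₂ (λ c d → occurrenceBound A B ≤ c + d)
    (sym (nOcc≡extensions N (3 ∷ 2 ∷ 1 ∷ []) (A ++ N ∷ B)))
    (sym (nOcc≡extensions N (3 ∷ 4 ∷ 1 ∷ 2 ∷ []) (A ++ N ∷ B)))
    (+-mono-≤ via321 via3412)
  where
  P321 = IsNOcc N (3 ∷ 2 ∷ 1 ∷ [])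
  P3412 = IsNOcc N (3 ∷ 4 ∷ 1 ∷ 2 ∷ [])
  via321 : inversions B ≤ extensions P321 [] (A ++ N ∷ B)
  via321 = begin
    inversions B                        ≤⟨ countPairs≤extensions P321 (N ∷ []) _ B
                                             (tabulate λ x∈B y y<ᵇx → 321-occurrence N _ y
                                               (<ᵇ≡true⇒< y<ᵇx) (lookup B<N x∈B)) ⟩
    extensions P321 (N ∷ []) B           ≤⟨ extensions-take P321 [] N B ⟩
    extensions P321 [] (N ∷ B)           ≤⟨ extensions-skip-++ P321 [] A (N ∷ B) ⟩
    extensions P321 [] (A ++ N ∷ B)      ∎
    where open ≤-Reasoning
  via3412 : sum (map (λ a → ascentsUnder a B) A) ≤ extensions P3412 [] (A ++ N ∷ B)
  via3412 = ≤-trans (sum-mono A A<N) (extensions-heads P3412 [] A (N ∷ B))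
    where
    ascents≤ : ∀ a → a < N → ascentsUnder a B ≤ extensions P3412 (a ∷ []) (N ∷ B)
    ascents≤ a a<N = ≤-trans
      (countPairs≤extensions P3412 (a ∷ N ∷ []) _ B
        (tabulate λ {x} _ y x<y<a → 3412-occurrence N a x y
          (<ᵇ≡true⇒< (∧≡true⇒ˡ x<y<a)) (<ᵇ≡true⇒< (∧≡true⇒ʳ {x <ᵇ y} x<y<a)) a<N))
      (extensions-take P3412 (a ∷ []) N B)
    sum-mono : ∀ As → All (_< N) As →
      sum (map (λ a → ascentsUnder a B) As) ≤ sum (map (λ a → extensions P3412 (a ∷ []) (N ∷ B)) As)
    sum-mono [] [] = z≤n
    sum-mono (a ∷ As) (a<N ∷ As<N) = +-mono-≤ (ascents≤ a a<N) (sum-mono As As<N)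

countPairs-snoc : ∀ R xs z → countPairs R (xs ++ z ∷ []) ≡ countPairs R xs + count (λ x → R x z) xs
countPairs-snoc R [] z = refl
countPairs-snoc R (x ∷ xs) z = begin
  count (R x) (xs ++ z ∷ []) + countPairs R (xs ++ z ∷ [])
    ≡⟨ cong₂ _+_ (count-++ (R x) xs (z ∷ [])) (countPairs-snoc R xs z) ⟩
  (count (R x) xs + count (R x) (z ∷ [])) + (countPairs R xs + count (λ y → R y z) xs)
    ≡⟨ regroup (R x z) ⟩
  (count (R x) xs + countPairs R xs) + count (λ y → R y z) (x ∷ xs) ∎
  where
  open ≡-Reasoning
  regroup : ∀ b → (count (R x) xs + (if b then 1 else 0)) + (countPairs R xs + count (λ y → R y z) xs)
              ≡ (count (R x) xs + countPairs R xs)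
                + (if b then suc (count (λ y → R y z) xs) else count (λ y → R y z) xs)
  regroup true = solve 3 (λ a b c → (a :+ con 1) :+ (b :+ c) := (a :+ b) :+ (con 1 :+ c)) refl
    (count (R x) xs) (countPairs R xs) (count (λ y → R y z) xs)
  regroup false = solve 3 (λ a b c → (a :+ con 0) :+ (b :+ c) := (a :+ b) :+ c) refl
    (count (R x) xs) (countPairs R xs) (count (λ y → R y z) xs)

gain ascentGain : List ℕ → List ℕ → ℕ → ℕ
gain A B z = above z B + below z B * above z A
ascentGain A B z = above z B + suc (below z B) * above z A

sum-ascentsUnder-snoc : ∀ A B z → sum (map (λ a → ascentsUnder a (B ++ z ∷ [])) A)
                                  ≡ sum (map (λ a → ascentsUnder a B) A) + below z B * above z A
sum-ascentsUnder-snoc [] B z = sym (*-zeroʳ (below z B))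
sum-ascentsUnder-snoc (a ∷ A) B z
  rewrite countPairs-snoc (λ x y → (x <ᵇ y) ∧ (y <ᵇ a)) B z | sum-ascentsUnder-snoc A B z with z <ᵇ a
... | true rewrite count-cong _ (_<ᵇ z) (λ x → ∧-identityʳ (x <ᵇ z)) B =
  solve 4 (λ p b q g → (p :+ b) :+ (q :+ b :* g) := (p :+ q) :+ b :* (con 1 :+ g)) refl
    (ascentsUnder a B) (below z B) (sum (map (λ a → ascentsUnder a B) A)) (above z A)
... | false rewrite count-cong _ (λ _ → false) (λ x → ∧-zeroʳ (x <ᵇ z)) B
                  | ∀⇒count≡0 (λ _ → false) B (λ _ → refl) =
  solve 4 (λ p b q g → (p :+ con 0) :+ (q :+ b :* g) := (p :+ q) :+ b :* g) refl
    (ascentsUnder a B) (below z B) (sum (map (λ a → ascentsUnder a B) A)) (above z A)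

occurrenceBound-snoc : ∀ A B z → occurrenceBound A (B ++ z ∷ []) ≡ occurrenceBound A B + gain A B z
occurrenceBound-snoc A B z
  rewrite countPairs-snoc (λ x y → y <ᵇ x) B z | sum-ascentsUnder-snoc A B z =
  solve 4 (λ i l s g → (i :+ l) :+ (s :+ g) := (i :+ s) :+ (l :+ g)) refl
    (inversions B) (above z B) (sum (map (λ a → ascentsUnder a B) A)) (below z B * above z A)

above+below≡length : ∀ z xs → z ∉ xs → above z xs + below z xs ≡ length xs
above+below≡length z [] _ = refl
above+below≡length z (x ∷ xs) z∉ with z <ᵇ x in z<ᵇx | x <ᵇ z in x<ᵇz
... | true  | true  = ⊥-elim (<-asym (<ᵇ≡true⇒< {z} {x} z<ᵇx) (<ᵇ≡true⇒< {x} {z} x<ᵇz))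
... | true  | false = cong suc (above+below≡length z xs (z∉ ∘ there))
... | false | true  = trans (+-suc _ _) (cong suc (above+below≡length z xs (z∉ ∘ there)))
... | false | false = ⊥-elim (z∉ (here (≤-antisym (<ᵇ≡false⇒≥ {x} {z} x<ᵇz) (<ᵇ≡false⇒≥ {z} {x} z<ᵇx))))

count-interval : ∀ Q (xs : List ℕ) lo hi → Unique xs → 1 ≤ lo →
  (∀ k → Q k ≡ true → lo ≤ k × k ≤ hi) → count Q xs ≤ suc hi ∸ lo
count-interval Q xs (suc lo) hi distinct _ Q⇒∈ with lo ≤? hi
... | no lo≰hi = ≤-trans (≤-reflexive (∀⇒count≡0 Q xs none)) z≤n
  where
  none : ∀ {k} → k ∈ xs → Q k ≡ false
  none {k} _ with Q k in Qk
  ... | true = ⊥-elim (lo≰hi (≤-trans (n≤1+n lo) (≤-trans (proj₁ (Q⇒∈ k Qk)) (proj₂ (Q⇒∈ k Qk)))))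
  ... | false = refl
... | yes lo≤hi = begin
  count Q xs                   ≡⟨ length-filterᵇ Q xs ⟨
  length (filterᵇ Q xs)        ≤⟨ Unique⇒length≤ (filter⁺ (T? ∘ Q) distinct) ⊆range ⟩
  length (range lo (hi ∸ lo))  ≡⟨ length-range lo (hi ∸ lo) ⟩
  hi ∸ lo                      ∎
  where
  open ≤-Reasoning
  ⊆range : ∀ {k} → k ∈ filterᵇ Q xs → k ∈ range lo (hi ∸ lo)
  ⊆range {k} k∈ with Q⇒∈ k (to T-≡ (proj₂ (∈-filter⁻ (T? ∘ Q) {xs = xs} k∈)))
  ... | lo<k , k≤hi = ∈-range⁺ lo (hi ∸ lo) lo<k (subst (k ≤_) (sym (m+[n∸m]≡n lo≤hi)) k≤hi)

below<self : ∀ z (xs : List ℕ) → Unique xs → All (1 ≤_) xs → 1 ≤ z → below z xs < z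
below<self (suc z) xs distinct positive _ = s≤s (begin
  count (_<ᵇ suc z) xs                ≡⟨ length-filterᵇ (_<ᵇ suc z) xs ⟨
  length (filterᵇ (_<ᵇ suc z) xs)     ≤⟨ Unique⇒length≤ (filter⁺ (T? ∘ (_<ᵇ suc z)) distinct) ⊆range ⟩
  length (range 0 z)                  ≡⟨ length-range 0 z ⟩
  z                                   ∎)
  where
  open ≤-Reasoning
  ⊆range : ∀ {k} → k ∈ filterᵇ (_<ᵇ suc z) xs → k ∈ range 0 z
  ⊆range {k} k∈ with ∈-filter⁻ (T? ∘ (_<ᵇ suc z)) k∈
  ... | k∈xs , k<ᵇ = ∈-range⁺ 0 z (lookup positive k∈xs) (≤-pred (<ᵇ≡true⇒< {k} {suc z} (to T-≡ k<ᵇ)))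

ascentGain≤gain : ∀ A P c Q z → c < z → ascentGain A P z ≤ gain A (P ++ c ∷ Q) z
ascentGain≤gain A P c Q z c<z
  rewrite count-++ (z <ᵇ_) P (c ∷ Q) | count-++ (_<ᵇ z) P (c ∷ Q) | <⇒<ᵇ≡true c<z =
  +-mono-≤ (m≤m+n (above z P) _) (*-monoˡ-≤ (above z A)
    (≤-trans (s≤s (m≤m+n (below z P) (below z Q))) (≤-reflexive (sym (+-suc (below z P) _)))))

reach-arithmetic : ∀ {t a a₁ s g m j} → t ≤ suc m ∸ j → a₁ + s ≡ j → a + s ≡ m → a₁ ≤ a → 2 ≤ a₁ + g →
                   t + 1 ≤ a + g
reach-arithmetic {t} {a} {a₁} {s} {g} {m} {j} t≤ refl refl a₁≤a two≤ = +-cancelʳ-≤ 2 (t + 1) (a + g) (begin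
  t + 1 + 2                ≤⟨ +-monoʳ-≤ (t + 1) two≤ ⟩
  t + 1 + (a₁ + g)         ≡⟨ solve 3 (λ t a₁ g → t :+ con 1 :+ (a₁ :+ g) := (t :+ a₁) :+ con 1 :+ g)
                                      refl t a₁ g ⟩
  (t + a₁) + 1 + g         ≤⟨ +-monoˡ-≤ g (+-monoˡ-≤ 1 t+a₁≤) ⟩
  suc a + 1 + g            ≡⟨ solve 2 (λ a g → con 1 :+ a :+ con 1 :+ g := a :+ g :+ con 2) refl a g ⟩
  a + g + 2                ∎)
  where
  open ≤-Reasoning
  t+a₁≤ : t + a₁ ≤ suc a
  t+a₁≤ = begin
    t + a₁                      ≤⟨ +-monoˡ-≤ a₁ t≤ ⟩
    suc (a + s) ∸ (a₁ + s) + a₁ ≡⟨ cong (λ n → n + a₁) (trans (cong₂ _∸_ (+-comm (suc a) s) (+-comm a₁ s))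
                                                                ([m+n]∸[m+o]≡n∸o s (suc a) a₁)) ⟩
    suc a ∸ a₁ + a₁             ≡⟨ m∸n+n≡m (m≤n⇒m≤1+n a₁≤a) ⟩
    suc a                       ∎

-- Cuts of A ++ B crossed by the letters of B

-- The two ways a letter of B makes the inequality #escapes ≤ occurrenceBound strict.
data Witness (A B : List ℕ) : Set where
  descent : ∀ B₁ d B₂ e B₃ → B ≡ B₁ ++ d ∷ B₂ ++ e ∷ B₃ → e < d → 1 ≤ gain A B₁ d → Witness A B
  ascent : ∀ B₁ c B₂ z B₃ → B ≡ B₁ ++ c ∷ B₂ ++ z ∷ B₃ → c < z →
           2 ≤ ascentGain A B₁ z → Witness A B

module Cuts (A : List ℕ) (K : ℕ) where

  r : ℕ
  r = length A

  -- Cut k of A ++ B escapes when a letter at most k follows position k, i.e. the first k letters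
  -- are not 1, …, k; for k > r the letters after position k are drop (k ∸ r) B.
  escapes : List ℕ → ℕ → Bool
  escapes B k = (r <ᵇ k) ∧ any (_≤ᵇ k) (drop (k ∸ r) B)

  #escapes : List ℕ → ℕ
  #escapes B = count (escapes B) (range 0 K)

  -- The cuts that a letter z appended to B lies beyond and is small enough to make escape
  reaches : List ℕ → ℕ → ℕ → Bool
  reaches B z k = (r <ᵇ k) ∧ ((k ∸ r) ≤ᵇ length B) ∧ (z ≤ᵇ k)

  #reaches : List ℕ → ℕ → ℕ
  #reaches B z = count (reaches B z) (range 0 K)

  #overlap : List ℕ → ℕ → ℕ
  #overlap B z = count (λ k → escapes B k ∧ reaches B z k) (range 0 K)

  Distinct : List ℕ → Set
  Distinct B = Unique (A ++ B) × All (1 ≤_) (A ++ B)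

  Slack : ℕ → List ℕ → Set
  Slack s B = #escapes B + s ≤ occurrenceBound A B

  Distinct-++⁻ˡ : ∀ P Q → Distinct (P ++ Q) → Distinct P
  Distinct-++⁻ˡ P Q (distinct , positive) =
    Unique-++⁻ˡ (A ++ P) Q (subst Unique (sym (++-assoc A P Q)) distinct) ,
    ++⁻ˡ (A ++ P) (subst (All (1 ≤_)) (sym (++-assoc A P Q)) positive)

  Distinct-prefix : ∀ P z Q → Distinct (P ++ z ∷ Q) → Distinct (P ++ z ∷ [])
  Distinct-prefix P z Q distinct =
    Distinct-++⁻ˡ (P ++ z ∷ []) Q (subst Distinct (sym (++-assoc P (z ∷ []) Q)) distinct)

  Distinct-snoc⇒∉ : ∀ B z → Distinct (B ++ z ∷ []) → z ∉ A ++ B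
  Distinct-snoc⇒∉ B z (distinct , _) =
    Unique-++-∷⇒∉ˡ (A ++ B) z [] (subst Unique (sym (++-assoc A B (z ∷ []))) distinct)

  escapes-snoc : ∀ B z k → escapes (B ++ z ∷ []) k ≡ escapes B k ∨ reaches B z k
  escapes-snoc B z k with r <ᵇ k
  ... | true = any-drop-snoc (_≤ᵇ k) (k ∸ r) B z
  ... | false = refl

  #escapes-snoc : ∀ B z → #escapes (B ++ z ∷ []) + #overlap B z ≡ #escapes B + #reaches B z
  #escapes-snoc B z = trans (cong (_+ #overlap B z) (count-cong _ _ (escapes-snoc B z) (range 0 K)))
                            (count-∨ (escapes B) (reaches B z) (range 0 K))

  #escapes-[] : #escapes [] ≡ 0
  #escapes-[] = ∀⇒count≡0 (escapes []) (range 0 K)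
    (λ {k} _ → trans (cong (λ xs → (r <ᵇ k) ∧ any (_≤ᵇ k) xs) (drop-[] (k ∸ r))) (∧-zeroʳ (r <ᵇ k)))

  Slack-weaken : ∀ {s t} B → s ≤ t → Slack t B → Slack s B
  Slack-weaken B s≤t = ≤-trans (+-monoʳ-≤ (#escapes B) s≤t)

  Slack-snoc : ∀ {s} δ B z → Slack s B → #reaches B z + δ ≤ gain A B z →
               Slack (s + #overlap B z + δ) (B ++ z ∷ [])
  Slack-snoc {s} δ B z slack enough = begin
    #escapes (B ++ z ∷ []) + (s + #overlap B z + δ)
      ≡⟨ solve 4 (λ e s o d → e :+ (s :+ o :+ d) := (e :+ o) :+ s :+ d) refl
           (#escapes (B ++ z ∷ [])) s (#overlap B z) δ ⟩
    #escapes (B ++ z ∷ []) + #overlap B z + s + δ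
      ≡⟨ cong (λ n → n + s + δ) (#escapes-snoc B z) ⟩
    #escapes B + #reaches B z + s + δ
      ≡⟨ solve 4 (λ e t s d → e :+ t :+ s :+ d := (e :+ s) :+ (t :+ d)) refl
           (#escapes B) (#reaches B z) s δ ⟩
    (#escapes B + s) + (#reaches B z + δ)
      ≤⟨ +-mono-≤ slack enough ⟩
    occurrenceBound A B + gain A B z
      ≡⟨ occurrenceBound-snoc A B z ⟨
    occurrenceBound A (B ++ z ∷ []) ∎
    where open ≤-Reasoning

  k₀ : ℕ → ℕ
  k₀ z = suc r ⊔ z

  r<k₀ : ∀ z → r < k₀ z
  r<k₀ z = m≤m⊔n (suc r) z

  z≤k₀ : ∀ z → z ≤ k₀ z
  z≤k₀ z = m≤n⊔m (suc r) z

  k₀∈range : ∀ z → k₀ z ≤ K → k₀ z ∈ range 0 K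
  k₀∈range z k₀≤K = ∈-range⁺ 0 K (≤-trans (s≤s z≤n) (r<k₀ z)) k₀≤K

  reaches-intro : ∀ X z k → r < k → k ∸ r ≤ length X → z ≤ k → reaches X z k ≡ true
  reaches-intro X z k r<k k≤ z≤k = ∧≡true (<⇒<ᵇ≡true r<k) (∧≡true (≤⇒≤ᵇ≡true k≤) (≤⇒≤ᵇ≡true z≤k))

  escapes-intro : ∀ P c Q k → r < k → k ∸ r ≤ length P → c ≤ k → escapes (P ++ c ∷ Q) k ≡ true
  escapes-intro P c Q k r<k k≤ c≤k =
    ∧≡true (<⇒<ᵇ≡true r<k) (any-∈ (_≤ᵇ k) (∈-drop-++-∷ (k ∸ r) P c Q k≤) (≤⇒≤ᵇ≡true c≤k))

  reaches⇒bounds : ∀ B z k → reaches B z k ≡ true → k₀ z ≤ k × k ≤ r + length B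
  reaches⇒bounds B z k reach = ⊔-lub r<k (≤ᵇ≡true⇒≤ {z} {k} (∧≡true⇒ʳ (∧≡true⇒ʳ {r <ᵇ k} reach))) ,
    subst (_≤ r + length B) (m+[n∸m]≡n (<⇒≤ r<k))
      (+-monoʳ-≤ r (≤ᵇ≡true⇒≤ {k ∸ r} {length B} (∧≡true⇒ˡ (∧≡true⇒ʳ {r <ᵇ k} reach))))
    where
    r<k : r < k
    r<k = <ᵇ≡true⇒< {r} {k} (∧≡true⇒ˡ reach)

  #reaches≤ : ∀ B z → #reaches B z ≤ suc (r + length B) ∸ k₀ z
  #reaches≤ B z = count-interval (reaches B z) (range 0 K) (k₀ z) (r + length B) (Unique-range 0 K)
    (≤-trans (s≤s z≤n) (r<k₀ z)) (reaches⇒bounds B z)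

  -- reaches X z is an interval of cuts starting at k₀ z, so it is empty as soon as k₀ z is missed.
  #reaches≡0 : ∀ X z → reaches X z (k₀ z) ≡ false → #reaches X z ≡ 0
  #reaches≡0 X z misses = ∀⇒count≡0 (reaches X z) (range 0 K) none
    where
    none : ∀ {k} → k ∈ range 0 K → reaches X z k ≡ false
    none {k} _ with reaches X z k in reach
    ... | false = refl
    ... | true with reaches⇒bounds X z k reach
    ...   | k₀≤k , k≤ = trans (sym (reaches-intro X z (k₀ z) (r<k₀ z)
                          (≤-trans (∸-monoˡ-≤ r (≤-trans k₀≤k k≤)) (≤-reflexive (m+n∸m≡n r (length X)))) (z≤k₀ z)))
                        misses

  -- The cuts z reaches lie in [k₀ z, r + length B]; when no letter of A exceeds z, all of A lies
  -- below z, which pushes k₀ z up to at least r + below z B + 1.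
  #reaches≤gain : ∀ B z → Distinct (B ++ z ∷ []) → #reaches B z ≤ gain A B z
  #reaches≤gain B z distinct with above z A in above-A
  ... | zero = begin
    #reaches B z                                   ≤⟨ #reaches≤ B z ⟩
    suc (r + length B) ∸ k₀ z                      ≤⟨ ∸-monoʳ-≤ (suc (r + length B)) k₀-large ⟩
    suc (r + length B) ∸ suc (r + below z B)       ≡⟨ [m+n]∸[m+o]≡n∸o r (length B) (below z B) ⟩
    length B ∸ below z B                           ≡⟨ cong (_∸ below z B) (above+below≡length z B z∉B) ⟨
    above z B + below z B ∸ below z B              ≡⟨ m+n∸n≡m (above z B) (below z B) ⟩
    above z B                                      ≡⟨ +-identityʳ (above z B) ⟨
    above z B + 0                                  ≡⟨ cong (above z B +_) (*-zeroʳ (below z B)) ⟨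
    above z B + below z B * 0                      ∎
    where
    open ≤-Reasoning
    z∉ = Distinct-snoc⇒∉ B z distinct
    z∉B = z∉ ∘ ∈-++⁺ʳ A
    distinct′ : Unique ((A ++ B) ++ z ∷ [])
    distinct′ = subst Unique (sym (++-assoc A B (z ∷ []))) (proj₁ distinct)
    positive′ : All (1 ≤_) ((A ++ B) ++ z ∷ [])
    positive′ = subst (All (1 ≤_)) (sym (++-assoc A B (z ∷ []))) (proj₂ distinct)
    below-A : below z A ≡ r
    below-A = trans (cong (_+ below z A) (sym above-A)) (above+below≡length z A (z∉ ∘ ∈-++⁺ˡ))
    k₀-large : suc (r + below z B) ≤ k₀ z
    k₀-large = begin
      suc (r + below z B)            ≡⟨ cong (λ n → suc (n + below z B)) below-A ⟨
      suc (below z A + below z B)    ≡⟨ cong suc (count-++ (_<ᵇ z) A B) ⟨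
      suc (below z (A ++ B))         ≤⟨ below<self z (A ++ B) (Unique-++⁻ˡ (A ++ B) (z ∷ []) distinct′)
                                          (++⁻ˡ (A ++ B) positive′)
                                          (lookup (++⁻ʳ (A ++ B) positive′) (here refl)) ⟩
      z                              ≤⟨ z≤k₀ z ⟩
      k₀ z                           ∎
  ... | suc g = begin
    #reaches B z                       ≤⟨ #reaches≤ B z ⟩
    suc (r + length B) ∸ k₀ z          ≤⟨ ∸-monoʳ-≤ (suc (r + length B)) (r<k₀ z) ⟩
    suc (r + length B) ∸ suc r         ≡⟨ m+n∸m≡n r (length B) ⟩
    length B                           ≡⟨ above+below≡length z B z∉B ⟨
    above z B + below z B              ≤⟨ +-monoʳ-≤ (above z B) (m≤m*n (below z B) (suc g)) ⟩
    above z B + below z B * suc g      ∎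
    where
    open ≤-Reasoning
    z∉B = Distinct-snoc⇒∉ B z distinct ∘ ∈-++⁺ʳ A

  Slack-++ : ∀ {s} P Q → Distinct (P ++ Q) → Slack s P → Slack s (P ++ Q)
  Slack-++ P [] _ slack = subst (Slack _) (sym (++-identityʳ P)) slack
  Slack-++ {s} P (z ∷ Q) distinct slack = subst (Slack s) (++-assoc P (z ∷ []) Q)
    (Slack-++ (P ++ z ∷ []) Q distinct′
      (Slack-weaken (P ++ z ∷ []) (≤-trans (m≤m+n s _) (m≤m+n _ 0))
        (Slack-snoc 0 P z slack
          (≤-trans (≤-reflexive (+-identityʳ _)) (#reaches≤gain P z (Distinct-prefix P z Q distinct))))))
    where
    distinct′ : Distinct ((P ++ z ∷ []) ++ Q)
    distinct′ = subst Distinct (sym (++-assoc P (z ∷ []) Q)) distinct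

  Slack-0 : ∀ B → Distinct B → Slack 0 B
  Slack-0 B distinct = Slack-++ [] B distinct (≤-trans (≤-reflexive (cong (_+ 0) #escapes-[])) z≤n)

  Slack-1-++ : ∀ P z Q → Distinct (P ++ z ∷ Q) → Slack 1 (P ++ z ∷ []) → Slack 1 (P ++ z ∷ Q)
  Slack-1-++ P z Q distinct slack = subst (Slack 1) (++-assoc P (z ∷ []) Q)
    (Slack-++ (P ++ z ∷ []) Q (subst Distinct (sym (++-assoc P (z ∷ []) Q)) distinct) slack)

  overlap-step : ∀ X z k → k ∈ range 0 K → escapes X k ≡ true → reaches X z k ≡ true →
                 Distinct (X ++ z ∷ []) → Slack 1 (X ++ z ∷ [])
  overlap-step X z k k∈ esc reach distinct =
    Slack-weaken (X ++ z ∷ [])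
      (≤-trans (∃⇒count≥1 (λ k → escapes X k ∧ reaches X z k) k∈ (∧≡true esc reach)) (m≤m+n _ 0))
      (Slack-snoc 0 X z (Slack-0 X (Distinct-++⁻ˡ X (z ∷ []) distinct))
        (≤-trans (≤-reflexive (+-identityʳ _)) (#reaches≤gain X z distinct)))

  gain-step : ∀ X z → #reaches X z + 1 ≤ gain A X z → Distinct (X ++ z ∷ []) → Slack 1 (X ++ z ∷ [])
  gain-step X z enough distinct =
    Slack-weaken (X ++ z ∷ []) (m≤n+m 1 _)
      (Slack-snoc 1 X z (Slack-0 X (Distinct-++⁻ˡ X (z ∷ []) distinct)) enough)

  descent-slack : ∀ B₁ d B₂ e B₃ →
    Distinct (B₁ ++ d ∷ B₂ ++ e ∷ B₃) → r + length (B₁ ++ d ∷ B₂ ++ e ∷ B₃) ≤ K →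
    e < d → 1 ≤ gain A B₁ d → Slack 1 (B₁ ++ d ∷ B₂ ++ e ∷ B₃)
  descent-slack B₁ d B₂ e B₃ distinct fits e<d gains with reaches B₁ d (k₀ d) in reach
  ... | false = Slack-1-++ B₁ d (B₂ ++ e ∷ B₃) distinct
    (gain-step B₁ d (subst (λ n → n + 1 ≤ gain A B₁ d) (sym (#reaches≡0 B₁ d reach)) gains)
      (Distinct-prefix B₁ d (B₂ ++ e ∷ B₃) distinct))
  ... | true = subst (Slack 1) (++-assoc B₁ (d ∷ B₂) (e ∷ B₃))
    (Slack-1-++ Y e B₃ distinct′ (overlap-step Y e (k₀ d) (k₀∈range d k₀≤K)
      (escapes-intro B₁ d B₂ (k₀ d) (r<k₀ d) k₀≤B₁ (z≤k₀ d))
      (reaches-intro Y e (k₀ d) (r<k₀ d) (≤-trans k₀≤B₁ (length-++-≤ˡ B₁)) (≤-trans (<⇒≤ e<d) (z≤k₀ d)))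
      (Distinct-prefix Y e B₃ distinct′)))
    where
    -- the cut k₀ d is crossed by d, and again by the later, smaller e
    Y = B₁ ++ d ∷ B₂
    distinct′ : Distinct (Y ++ e ∷ B₃)
    distinct′ = subst Distinct (sym (++-assoc B₁ (d ∷ B₂) (e ∷ B₃))) distinct
    k₀≤B₁ : k₀ d ∸ r ≤ length B₁
    k₀≤B₁ = ≤ᵇ≡true⇒≤ (∧≡true⇒ˡ (∧≡true⇒ʳ {r <ᵇ k₀ d} reach))
    k₀≤K : k₀ d ≤ K
    k₀≤K = ≤-trans (proj₂ (reaches⇒bounds B₁ d (k₀ d) reach))
                   (≤-trans (+-monoʳ-≤ r (length-++-≤ˡ B₁)) fits)

  unescaped⇒below-take : ∀ X z → escapes X (k₀ z) ≡ false → below z X ≡ below z (take (k₀ z ∸ r) X)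
  unescaped⇒below-take X z unescaped = begin
    below z X                                  ≡⟨ cong (below z) (take++drop≡id j X) ⟨
    below z (take j X ++ drop j X)             ≡⟨ count-++ (_<ᵇ z) (take j X) (drop j X) ⟩
    below z (take j X) + below z (drop j X)    ≡⟨ cong (below z (take j X) +_) below-drop ⟩
    below z (take j X) + 0                     ≡⟨ +-identityʳ _ ⟩
    below z (take j X)                         ∎
    where
    open ≡-Reasoning
    j = k₀ z ∸ r
    nothing-after : any (_≤ᵇ k₀ z) (drop j X) ≡ false
    nothing-after rewrite <⇒<ᵇ≡true (r<k₀ z) = unescaped
    below-drop : below z (drop j X) ≡ 0
    below-drop = ∀⇒count≡0 (_<ᵇ z) (drop j X) λ {y} y∈ → ≥⇒<ᵇ≡false (≤-trans (z≤k₀ z)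
      (<⇒≤ (≤ᵇ≡false⇒> {y} {k₀ z} (any≡false⇒ (_≤ᵇ k₀ z) (drop j X) nothing-after y∈))))

  #reaches≤ʳ : ∀ X z → #reaches X z ≤ suc (length X) ∸ (k₀ z ∸ r)
  #reaches≤ʳ X z = ≤-trans (#reaches≤ X z) (≤-reflexive (begin
    suc (r + length X) ∸ k₀ z                  ≡⟨ cong (suc (r + length X) ∸_) (m+[n∸m]≡n (<⇒≤ (r<k₀ z))) ⟨
    suc (r + length X) ∸ (r + (k₀ z ∸ r))      ≡⟨ cong (_∸ (r + (k₀ z ∸ r))) (+-suc r (length X)) ⟨
    r + suc (length X) ∸ (r + (k₀ z ∸ r))      ≡⟨ [m+n]∸[m+o]≡n∸o r (suc (length X)) (k₀ z ∸ r) ⟩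
    suc (length X) ∸ (k₀ z ∸ r)                ∎))
    where open ≡-Reasoning

  -- If z reaches k₀ z but nothing escapes there, all letters below z lie in X₁ = take (k₀ z ∸ r) X,
  -- which contains B₁ ++ c, so z gains more than the cuts it can reach.
  unescaped-reach : ∀ B₁ c B₂ z → c < z → z ∉ B₁ ++ c ∷ B₂ → 2 ≤ ascentGain A B₁ z →
    escapes (B₁ ++ c ∷ B₂) (k₀ z) ≡ false → reaches (B₁ ++ c ∷ B₂) z (k₀ z) ≡ true →
    #reaches (B₁ ++ c ∷ B₂) z + 1 ≤ gain A (B₁ ++ c ∷ B₂) z
  unescaped-reach B₁ c B₂ z c<z z∉X gains unescaped reach =
    reach-arithmetic (#reaches≤ʳ X z) above+below-X₁ (above+below≡length z X z∉X)
      (count-take≤ (z <ᵇ_) j X) gains-X₁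
    where
    X = B₁ ++ c ∷ B₂
    j = k₀ z ∸ r
    X₁ = take j X
    below-X₁ = unescaped⇒below-take X z unescaped
    B₁<j : length B₁ < j
    B₁<j with j ≤? length B₁
    ... | no j≰B₁ = ≰⇒> j≰B₁
    ... | yes j≤B₁
      with trans (sym (escapes-intro B₁ c B₂ (k₀ z) (r<k₀ z) j≤B₁ (≤-trans (<⇒≤ c<z) (z≤k₀ z)))) unescaped
    ...   | ()
    above+below-X₁ : above z X₁ + below z X ≡ j
    above+below-X₁ = begin
      above z X₁ + below z X   ≡⟨ cong (above z X₁ +_) below-X₁ ⟩
      above z X₁ + below z X₁  ≡⟨ above+below≡length z X₁ (z∉X ∘ ∈-take⁻ j X) ⟩
      length X₁                ≡⟨ length-take j X ⟩
      j ⊓ length X             ≡⟨ m≤n⇒m⊓n≡m (≤ᵇ≡true⇒≤ (∧≡true⇒ˡ (∧≡true⇒ʳ {r <ᵇ k₀ z} reach))) ⟩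
      j                        ∎
      where open ≡-Reasoning
    gains-X₁ : 2 ≤ above z X₁ + below z X * above z A
    gains-X₁ = begin
      2                                                    ≤⟨ gains ⟩
      ascentGain A B₁ z                                    ≤⟨ ascentGain≤gain A B₁ c _ z c<z ⟩
      gain A (B₁ ++ c ∷ take (j ∸ suc (length B₁)) B₂) z   ≡⟨ cong (λ U → gain A U z) (take-++-∷ j B₁ c B₂ B₁<j) ⟨
      gain A X₁ z                                          ≡⟨ cong (λ n → above z X₁ + n * above z A) below-X₁ ⟨
      above z X₁ + below z X * above z A                   ∎
      where open ≤-Reasoning

  ascent-slack : ∀ B₁ c B₂ z B₃ →
    Distinct (B₁ ++ c ∷ B₂ ++ z ∷ B₃) → r + length (B₁ ++ c ∷ B₂ ++ z ∷ B₃) ≤ K →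
    c < z → 2 ≤ ascentGain A B₁ z → Slack 1 (B₁ ++ c ∷ B₂ ++ z ∷ B₃)
  ascent-slack B₁ c B₂ z B₃ distinct fits c<z gains =
    subst (Slack 1) (++-assoc B₁ (c ∷ B₂) (z ∷ B₃)) (Slack-1-++ X z B₃ distinct′ last-step)
    where
    X = B₁ ++ c ∷ B₂
    distinct′ : Distinct (X ++ z ∷ B₃)
    distinct′ = subst Distinct (sym (++-assoc B₁ (c ∷ B₂) (z ∷ B₃))) distinct
    distinctX = Distinct-prefix X z B₃ distinct′
    X-fits : r + length X ≤ K
    X-fits = ≤-trans (+-monoʳ-≤ r (length-++-≤ˡ X))
      (subst (λ U → r + length U ≤ K) (sym (++-assoc B₁ (c ∷ B₂) (z ∷ B₃))) fits)
    last-step : Slack 1 (X ++ z ∷ [])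
    last-step with escapes X (k₀ z) in esc | reaches X z (k₀ z) in reach
    ... | true | true = overlap-step X z (k₀ z)
      (k₀∈range z (≤-trans (proj₂ (reaches⇒bounds X z (k₀ z) reach)) X-fits)) esc reach distinctX
    ... | _ | false = gain-step X z (subst (λ n → n + 1 ≤ gain A X z) (sym (#reaches≡0 X z reach))
      (≤-trans (≤-trans (s≤s z≤n) gains) (ascentGain≤gain A B₁ c B₂ z c<z))) distinctX
    ... | false | true = gain-step X z
      (unescaped-reach B₁ c B₂ z c<z (Distinct-snoc⇒∉ X z distinctX ∘ ∈-++⁺ʳ A) gains esc reach) distinctX

  Witness⇒Slack-1 : ∀ B → Witness A B → Distinct B → r + length B ≤ K → Slack 1 B
  Witness⇒Slack-1 B (descent B₁ d B₂ e B₃ refl e<d gains) distinct fits =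
    descent-slack B₁ d B₂ e B₃ distinct fits e<d gains
  Witness⇒Slack-1 B (ascent B₁ c B₂ z B₃ refl c<z gains) distinct fits =
    ascent-slack B₁ c B₂ z B₃ distinct fits c<z gains

-- Occurrences of the patterns of Φ

ranks : ∀ s {p} → std s ≡ p → Pointwise (λ x i → rank s x ≡ i) s p
ranks s std≡ = subst (Pointwise _ s) (trans (sym (std≡map-rank s)) std≡) (map-rank s)
  where
  map-rank : ∀ xs → Pointwise (λ x i → rank s x ≡ i) xs (map (rank s) xs)
  map-rank [] = []
  map-rank (x ∷ xs) = refl ∷ map-rank xs

rank-< : ∀ s x y {i j} → rank s x ≡ i → rank s y ≡ j → {True (i <? j)} → x < y
rank-< s x y refl refl {i<j} with x <? y
... | yes x<y = x<y
... | no x≮y = ⊥-elim (<⇒≱ (toWitness i<j) (s≤s (count-mono (_<ᵇ y) (_<ᵇ x)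
  (λ z z<ᵇy → <⇒<ᵇ≡true (<-≤-trans (<ᵇ≡true⇒< z<ᵇy) (≮⇒≥ x≮y))) s)))

count-mono-< : ∀ (P Q : ℕ → Bool) → (∀ x → P x ≡ true → Q x ≡ true) →
               ∀ {z xs} → z ∈ xs → P z ≡ false → Q z ≡ true → count P xs < count Q xs
count-mono-< P Q P⇒Q {xs = _ ∷ xs} (here refl) Pz Qz rewrite Pz | Qz = s≤s (count-mono P Q P⇒Q xs)
count-mono-< P Q P⇒Q {xs = y ∷ _} (there z∈) Pz Qz with P y in Py | Q y in Qy
... | true  | true  = s≤s (count-mono-< P Q P⇒Q z∈ Pz Qz)
... | false | true  = m≤n⇒m≤1+n (count-mono-< P Q P⇒Q z∈ Pz Qz)
... | false | false = count-mono-< P Q P⇒Q z∈ Pz Qz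
... | true  | false with trans (sym (P⇒Q y Py)) Qy
...   | ()

count-true : ∀ (xs : List ℕ) → count (λ _ → true) xs ≡ length xs
count-true [] = refl
count-true (x ∷ xs) = cong suc (count-true xs)

maxL-top : ∀ s {t} → t ∈ s → All (_≤ t) s → maxL s ≡ t
maxL-top s {t} t∈ s≤t = ≤-antisym (maxL≤ s s≤t) (≤maxL s t∈)
  where
  maxL≤ : ∀ s → All (_≤ t) s → maxL s ≤ t
  maxL≤ [] _ = z≤n
  maxL≤ (x ∷ s) (x≤t ∷ s≤t) = ⊔-lub x≤t (maxL≤ s s≤t)
  ≤maxL : ∀ s → t ∈ s → t ≤ maxL s
  ≤maxL (x ∷ s) (here refl) = m≤m⊔n x _
  ≤maxL (x ∷ s) (there t∈) = ≤-trans (≤maxL s t∈) (m≤n⊔m x _)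

maxL∈ : ∀ x s → maxL (x ∷ s) ∈ x ∷ s
maxL∈ x [] = here (⊔-identityʳ x)
maxL∈ x (y ∷ s) with ⊔-sel x (maxL (y ∷ s))
... | inj₁ x⊔≡x = here x⊔≡x
... | inj₂ x⊔≡m = subst (_∈ x ∷ y ∷ s) (sym x⊔≡m) (there (maxL∈ y s))

top-rank⇒maxL : ∀ s {x} → x ∈ s → rank s x ≡ length s → maxL s ≡ x
top-rank⇒maxL s {x} x∈ top = maxL-top s x∈ (tabulate below-x)
  where
  below-x : ∀ {y} → y ∈ s → y ≤ x
  below-x {y} y∈ = ≮⇒≥ λ x<y → <-irrefl top (begin-strict
    rank s x                   ≤⟨ count-mono-< (_<ᵇ x) (_<ᵇ y) (λ z z<ᵇx → <⇒<ᵇ≡true (<-trans (<ᵇ≡true⇒< z<ᵇx) x<y))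
                                    x∈ (<ᵇ-irrefl x) (<⇒<ᵇ≡true x<y) ⟩
    count (_<ᵇ y) s            <⟨ count-mono-< (_<ᵇ y) (λ _ → true) (λ _ _ → refl) y∈ (<ᵇ-irrefl y) refl ⟩
    count (λ _ → true) s       ≡⟨ count-true s ⟩
    length s                   ∎)
    where open ≤-Reasoning

⊆-split-at : ∀ pre {x N} post A B → Unique (A ++ N ∷ B) → pre ++ x ∷ post ⊆ A ++ N ∷ B → x ≡ N →
             pre ⊆ A × post ⊆ B
⊆-split-at pre {N = N} post A B distinct sub refl with ++-∷-⊆⁻ pre N post sub
... | P , Q , eq , pre⊆P , post⊆Q
  with ++-∷-cancel A B P Q (Unique-++-∷⇒∉ˡ A N B distinct)
                           (Unique-++-∷⇒∉ˡ P N Q (subst Unique eq distinct)) eq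
...   | refl , refl = pre⊆P , post⊆Q

descent-witness : ∀ A {B} pre d e → pre ++ d ∷ e ∷ [] ⊆ B → e < d →
                  (∀ B₁ → pre ⊆ B₁ → 1 ≤ gain A B₁ d) → Witness A B
descent-witness A pre d e sub e<d gains with ++-∷-⊆⁻ pre d (e ∷ []) sub
... | B₁ , Q , refl , pre⊆B₁ , e⊆Q with ++-∷-⊆⁻ [] e [] e⊆Q
...   | B₂ , B₃ , refl , _ , _ = descent B₁ d B₂ e B₃ refl e<d (gains B₁ pre⊆B₁)

ascent-witness : ∀ A {B} pre c z → pre ++ c ∷ z ∷ [] ⊆ B → c < z →
                 (∀ B₁ → pre ⊆ B₁ → 2 ≤ ascentGain A B₁ z) → Witness A B
ascent-witness A pre c z sub c<z gains with ++-∷-⊆⁻ pre c (z ∷ []) sub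
... | B₁ , Q , refl , pre⊆B₁ , z⊆Q with ++-∷-⊆⁻ [] z [] z⊆Q
...   | B₂ , B₃ , refl , _ , _ = ascent B₁ c B₂ z B₃ refl c<z (gains B₁ pre⊆B₁)

top-rank⇒≡ : ∀ s {x N} → x ∈ s → rank s x ≡ length s → maxL s ≡ N → x ≡ N
top-rank⇒≡ s x∈ top max≡ = trans (sym (top-rank⇒maxL s x∈ top)) max≡

descent-gain-above : ∀ A B z → 1 ≤ above z B → 1 ≤ gain A B z
descent-gain-above A B z 1≤a = ≤-trans 1≤a (m≤m+n (above z B) _)

descent-gain-below : ∀ A B z → 1 ≤ below z B → 1 ≤ above z A → 1 ≤ gain A B z
descent-gain-below A B z 1≤s 1≤g = ≤-trans (*-mono-≤ 1≤s 1≤g) (m≤n+m _ (above z B))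

ascent-gain-A : ∀ A B z → 2 ≤ above z A → 2 ≤ ascentGain A B z
ascent-gain-A A B z 2≤g = ≤-trans 2≤g (≤-trans (m≤m+n (above z A) _) (m≤n+m _ (above z B)))

ascent-gain-below : ∀ A B z → 1 ≤ below z B → 1 ≤ above z A → 2 ≤ ascentGain A B z
ascent-gain-below A B z 1≤s 1≤g = ≤-trans (*-mono-≤ (s≤s 1≤s) 1≤g) (m≤n+m _ (above z B))

ascent-gain-above : ∀ A B z → 1 ≤ above z B → 1 ≤ above z A → 2 ≤ ascentGain A B z
ascent-gain-above A B z 1≤a 1≤g = +-mono-≤ 1≤a (≤-trans 1≤g (m≤m+n (above z A) _))

ascent-gain-above² : ∀ A B z → 2 ≤ above z B → 2 ≤ ascentGain A B z
ascent-gain-above² A B z 2≤a = ≤-trans 2≤a (m≤m+n (above z B) _)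

above≥1 : ∀ {z x ys} → x ∷ [] ⊆ ys → z < x → 1 ≤ above z ys
above≥1 sub z<x = ⊆⇒length≤count _ sub (<⇒<ᵇ≡true z<x ∷ [])

above≥2 : ∀ {z x y ys} → x ∷ y ∷ [] ⊆ ys → z < x → z < y → 2 ≤ above z ys
above≥2 sub z<x z<y = ⊆⇒length≤count _ sub (<⇒<ᵇ≡true z<x ∷ <⇒<ᵇ≡true z<y ∷ [])

below≥1 : ∀ {z x ys} → x ∷ [] ⊆ ys → x < z → 1 ≤ below z ys
below≥1 sub x<z = ⊆⇒length≤count _ sub (<⇒<ᵇ≡true x<z ∷ [])

PatternWitness : List ℕ → Set
PatternWitness p = ∀ {N} A B s → Unique (A ++ N ∷ B) → s ⊆ A ++ N ∷ B → std s ≡ p → maxL s ≡ N → Witness A B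

witness-4321 : PatternWitness (4 ∷ 3 ∷ 2 ∷ 1 ∷ [])
witness-4321 A B s distinct s⊆ std≡ max≡ with ranks s std≡
witness-4321 A B s@(x₁ ∷ x₂ ∷ x₃ ∷ x₄ ∷ []) distinct s⊆ std≡ max≡ | q₁ ∷ q₂ ∷ q₃ ∷ q₄ ∷ []
  with ⊆-split-at [] (x₂ ∷ x₃ ∷ x₄ ∷ []) A B distinct s⊆ (top-rank⇒≡ s (here refl) q₁ max≡)
... | _ , rest⊆B = descent-witness A (x₂ ∷ []) x₃ x₄ rest⊆B (rank-< s x₄ x₃ q₄ q₃) λ B₁ x₂⊆B₁ →
  descent-gain-above A B₁ x₃ (above≥1 x₂⊆B₁ (rank-< s x₃ x₂ q₃ q₂))

witness-34512 : PatternWitness (3 ∷ 4 ∷ 5 ∷ 1 ∷ 2 ∷ [])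
witness-34512 A B s distinct s⊆ std≡ max≡ with ranks s std≡
witness-34512 A B s@(x₁ ∷ x₂ ∷ x₃ ∷ x₄ ∷ x₅ ∷ []) distinct s⊆ std≡ max≡ | q₁ ∷ q₂ ∷ q₃ ∷ q₄ ∷ q₅ ∷ []
  with ⊆-split-at (x₁ ∷ x₂ ∷ []) (x₄ ∷ x₅ ∷ []) A B distinct s⊆
         (top-rank⇒≡ s (there (there (here refl))) q₃ max≡)
... | x₁x₂⊆A , rest⊆B = ascent-witness A [] x₄ x₅ rest⊆B (rank-< s x₄ x₅ q₄ q₅) λ B₁ _ →
  ascent-gain-A A B₁ x₅ (above≥2 x₁x₂⊆A (rank-< s x₅ x₁ q₅ q₁) (rank-< s x₅ x₂ q₅ q₂))

witness-45123 : PatternWitness (4 ∷ 5 ∷ 1 ∷ 2 ∷ 3 ∷ [])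
witness-45123 A B s distinct s⊆ std≡ max≡ with ranks s std≡
witness-45123 A B s@(x₁ ∷ x₂ ∷ x₃ ∷ x₄ ∷ x₅ ∷ []) distinct s⊆ std≡ max≡ | q₁ ∷ q₂ ∷ q₃ ∷ q₄ ∷ q₅ ∷ []
  with ⊆-split-at (x₁ ∷ []) (x₃ ∷ x₄ ∷ x₅ ∷ []) A B distinct s⊆ (top-rank⇒≡ s (there (here refl)) q₂ max≡)
... | x₁⊆A , rest⊆B = ascent-witness A (x₃ ∷ []) x₄ x₅ rest⊆B (rank-< s x₄ x₅ q₄ q₅) λ B₁ x₃⊆B₁ →
  ascent-gain-below A B₁ x₅ (below≥1 x₃⊆B₁ (rank-< s x₃ x₅ q₃ q₅))
                    (above≥1 x₁⊆A (rank-< s x₅ x₁ q₅ q₁))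

witness-35412 : PatternWitness (3 ∷ 5 ∷ 4 ∷ 1 ∷ 2 ∷ [])
witness-35412 A B s distinct s⊆ std≡ max≡ with ranks s std≡
witness-35412 A B s@(x₁ ∷ x₂ ∷ x₃ ∷ x₄ ∷ x₅ ∷ []) distinct s⊆ std≡ max≡ | q₁ ∷ q₂ ∷ q₃ ∷ q₄ ∷ q₅ ∷ []
  with ⊆-split-at (x₁ ∷ []) (x₃ ∷ x₄ ∷ x₅ ∷ []) A B distinct s⊆ (top-rank⇒≡ s (there (here refl)) q₂ max≡)
... | x₁⊆A , rest⊆B = ascent-witness A (x₃ ∷ []) x₄ x₅ rest⊆B (rank-< s x₄ x₅ q₄ q₅) λ B₁ x₃⊆B₁ →
  ascent-gain-above A B₁ x₅ (above≥1 x₃⊆B₁ (rank-< s x₅ x₃ q₅ q₃))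
                    (above≥1 x₁⊆A (rank-< s x₅ x₁ q₅ q₁))

witness-43512 : PatternWitness (4 ∷ 3 ∷ 5 ∷ 1 ∷ 2 ∷ [])
witness-43512 A B s distinct s⊆ std≡ max≡ with ranks s std≡
witness-43512 A B s@(x₁ ∷ x₂ ∷ x₃ ∷ x₄ ∷ x₅ ∷ []) distinct s⊆ std≡ max≡ | q₁ ∷ q₂ ∷ q₃ ∷ q₄ ∷ q₅ ∷ []
  with ⊆-split-at (x₁ ∷ x₂ ∷ []) (x₄ ∷ x₅ ∷ []) A B distinct s⊆
         (top-rank⇒≡ s (there (there (here refl))) q₃ max≡)
... | x₁x₂⊆A , rest⊆B = ascent-witness A [] x₄ x₅ rest⊆B (rank-< s x₄ x₅ q₄ q₅) λ B₁ _ →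
  ascent-gain-A A B₁ x₅ (above≥2 x₁x₂⊆A (rank-< s x₅ x₁ q₅ q₁) (rank-< s x₅ x₂ q₅ q₂))

witness-45132 : PatternWitness (4 ∷ 5 ∷ 1 ∷ 3 ∷ 2 ∷ [])
witness-45132 A B s distinct s⊆ std≡ max≡ with ranks s std≡
witness-45132 A B s@(x₁ ∷ x₂ ∷ x₃ ∷ x₄ ∷ x₅ ∷ []) distinct s⊆ std≡ max≡ | q₁ ∷ q₂ ∷ q₃ ∷ q₄ ∷ q₅ ∷ []
  with ⊆-split-at (x₁ ∷ []) (x₃ ∷ x₄ ∷ x₅ ∷ []) A B distinct s⊆ (top-rank⇒≡ s (there (here refl)) q₂ max≡)
... | x₁⊆A , rest⊆B = descent-witness A (x₃ ∷ []) x₄ x₅ rest⊆B (rank-< s x₅ x₄ q₅ q₄) λ B₁ x₃⊆B₁ →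
  descent-gain-below A B₁ x₄ (below≥1 x₃⊆B₁ (rank-< s x₃ x₄ q₃ q₄))
                     (above≥1 x₁⊆A (rank-< s x₄ x₁ q₄ q₁))

witness-45213 : PatternWitness (4 ∷ 5 ∷ 2 ∷ 1 ∷ 3 ∷ [])
witness-45213 A B s distinct s⊆ std≡ max≡ with ranks s std≡
witness-45213 A B s@(x₁ ∷ x₂ ∷ x₃ ∷ x₄ ∷ x₅ ∷ []) distinct s⊆ std≡ max≡ | q₁ ∷ q₂ ∷ q₃ ∷ q₄ ∷ q₅ ∷ []
  with ⊆-split-at (x₁ ∷ []) (x₃ ∷ x₄ ∷ x₅ ∷ []) A B distinct s⊆ (top-rank⇒≡ s (there (here refl)) q₂ max≡)
... | x₁⊆A , rest⊆B = ascent-witness A (x₃ ∷ []) x₄ x₅ rest⊆B (rank-< s x₄ x₅ q₄ q₅) λ B₁ x₃⊆B₁ →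
  ascent-gain-below A B₁ x₅ (below≥1 x₃⊆B₁ (rank-< s x₃ x₅ q₃ q₅))
                    (above≥1 x₁⊆A (rank-< s x₅ x₁ q₅ q₁))

witness-53412 : PatternWitness (5 ∷ 3 ∷ 4 ∷ 1 ∷ 2 ∷ [])
witness-53412 A B s distinct s⊆ std≡ max≡ with ranks s std≡
witness-53412 A B s@(x₁ ∷ x₂ ∷ x₃ ∷ x₄ ∷ x₅ ∷ []) distinct s⊆ std≡ max≡ | q₁ ∷ q₂ ∷ q₃ ∷ q₄ ∷ q₅ ∷ []
  with ⊆-split-at [] (x₂ ∷ x₃ ∷ x₄ ∷ x₅ ∷ []) A B distinct s⊆ (top-rank⇒≡ s (here refl) q₁ max≡)
... | _ , rest⊆B = ascent-witness A (x₂ ∷ x₃ ∷ []) x₄ x₅ rest⊆B (rank-< s x₄ x₅ q₄ q₅) λ B₁ x₂x₃⊆B₁ →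
  ascent-gain-above² A B₁ x₅ (above≥2 x₂x₃⊆B₁ (rank-< s x₅ x₂ q₅ q₂) (rank-< s x₅ x₃ q₅ q₃))

witness-45312 : PatternWitness (4 ∷ 5 ∷ 3 ∷ 1 ∷ 2 ∷ [])
witness-45312 A B s distinct s⊆ std≡ max≡ with ranks s std≡
witness-45312 A B s@(x₁ ∷ x₂ ∷ x₃ ∷ x₄ ∷ x₅ ∷ []) distinct s⊆ std≡ max≡ | q₁ ∷ q₂ ∷ q₃ ∷ q₄ ∷ q₅ ∷ []
  with ⊆-split-at (x₁ ∷ []) (x₃ ∷ x₄ ∷ x₅ ∷ []) A B distinct s⊆ (top-rank⇒≡ s (there (here refl)) q₂ max≡)
... | x₁⊆A , rest⊆B = ascent-witness A (x₃ ∷ []) x₄ x₅ rest⊆B (rank-< s x₄ x₅ q₄ q₅) λ B₁ x₃⊆B₁ →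
  ascent-gain-above A B₁ x₅ (above≥1 x₃⊆B₁ (rank-< s x₅ x₃ q₅ q₃))
                    (above≥1 x₁⊆A (rank-< s x₅ x₁ q₅ q₁))

witness-45231 : PatternWitness (4 ∷ 5 ∷ 2 ∷ 3 ∷ 1 ∷ [])
witness-45231 A B s distinct s⊆ std≡ max≡ with ranks s std≡
witness-45231 A B s@(x₁ ∷ x₂ ∷ x₃ ∷ x₄ ∷ x₅ ∷ []) distinct s⊆ std≡ max≡ | q₁ ∷ q₂ ∷ q₃ ∷ q₄ ∷ q₅ ∷ []
  with ⊆-split-at (x₁ ∷ []) (x₃ ∷ x₄ ∷ x₅ ∷ []) A B distinct s⊆ (top-rank⇒≡ s (there (here refl)) q₂ max≡)
... | x₁⊆A , rest⊆B = descent-witness A (x₃ ∷ []) x₄ x₅ rest⊆B (rank-< s x₅ x₄ q₅ q₄) λ B₁ x₃⊆B₁ →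
  descent-gain-below A B₁ x₄ (below≥1 x₃⊆B₁ (rank-< s x₃ x₄ q₃ q₄))
                     (above≥1 x₁⊆A (rank-< s x₄ x₁ q₄ q₁))

Φ-witness : ∀ {p} → p ∈ Φ → PatternWitness p
Φ-witness (here refl) = witness-4321
Φ-witness (there (here refl)) = witness-34512
Φ-witness (there (there (here refl))) = witness-45123
Φ-witness (there (there (there (here refl)))) = witness-35412
Φ-witness (there (there (there (there (here refl))))) = witness-43512
Φ-witness (there (there (there (there (there (here refl)))))) = witness-45132
Φ-witness (there (there (there (there (there (there (here refl))))))) = witness-45213
Φ-witness (there (there (there (there (there (there (there (here refl)))))))) = witness-53412
Φ-witness (there (there (there (there (there (there (there (there (here refl))))))))) = witness-45312
Φ-witness (there (there (there (there (there (there (there (there (there (here refl)))))))))) = witness-45231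

IsPerm⇒bounds : ∀ {N w} → IsPerm N w → ∀ {y} → y ∈ w → 1 ≤ y × y ≤ N
IsPerm⇒bounds {N} w↭ y∈ = ∈-range⁻ 0 N (∈-resp-↭ (subst (_ ↭_) (range1≡range N) w↭) y∈)

IsPerm⇒Unique : ∀ {N w} → IsPerm N w → Unique w
IsPerm⇒Unique {N} w↭ = Unique-resp-↭ (subst Unique (sym (range1≡range N)) (Unique-range 0 N)) (↭-sym w↭)

IsPerm-delete-top : ∀ N A B → IsPerm N (A ++ N ∷ B) → IsPerm (N ∸ 1) (A ++ B)
IsPerm-delete-top zero A B w↭ with IsPerm⇒bounds w↭ (∈-++⁺ʳ A (here refl))
... | () , _
IsPerm-delete-top (suc n) A B w↭ = subst (A ++ B ↭_) (sym (range1≡range n))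
  (subst (A ++ B ↭_) (++-identityʳ _) (drop-mid A (range 0 n)
    (subst (A ++ suc n ∷ B ↭_) (trans (range1≡range (suc n)) (range-snoc 0 n)) w↭)))

IsPerm⇒below-top : ∀ N A B → IsPerm N (A ++ N ∷ B) → All (_< N) A × All (_< N) B
IsPerm⇒below-top N A B w↭ =
  tabulate (λ y∈ → ≤∧≢⇒< (bound (∈-++⁺ˡ y∈)) (λ { refl → Unique-++-∷⇒∉ˡ A N B distinct y∈ })) ,
  tabulate (λ y∈ → ≤∧≢⇒< (bound (∈-++⁺ʳ A (there y∈))) (λ { refl → Unique-++-∷⇒∉ʳ A N B distinct y∈ }))
  where
  distinct = IsPerm⇒Unique w↭
  bound : ∀ {y} → y ∈ A ++ N ∷ B → y ≤ N
  bound = proj₂ ∘ IsPerm⇒bounds w↭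

delN-++-∷ : ∀ N A B → N ∉ A → N ∉ B → delN N (A ++ N ∷ B) ≡ A ++ B
delN-++-∷ N [] B _ N∉B rewrite ≡ᵇ-refl N = keep-all B N∉B
  where
  keep-all : ∀ xs → N ∉ xs → delN N xs ≡ xs
  keep-all [] _ = refl
  keep-all (x ∷ xs) N∉ rewrite ≢⇒≡ᵇ≡false {x} {N} (λ x≡N → N∉ (here (sym x≡N))) =
    cong (x ∷_) (keep-all xs (N∉ ∘ there))
delN-++-∷ N (a ∷ A) B N∉A N∉B rewrite ≢⇒≡ᵇ≡false {a} {N} (λ a≡N → N∉A (here (sym a≡N))) =
  cong (a ∷_) (delN-++-∷ N A B (N∉A ∘ there) N∉B)

posOf-++-∷ : ∀ N A B → N ∉ A → posOf N (A ++ N ∷ B) ≡ suc (length A)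
posOf-++-∷ N [] B _ rewrite ≡ᵇ-refl N = refl
posOf-++-∷ N (a ∷ A) B N∉A rewrite ≢⇒≡ᵇ≡false {a} {N} (λ a≡N → N∉A (here (sym a≡N))) =
  cong suc (posOf-++-∷ N A B (N∉A ∘ there))

drop-++-≥ : ∀ k (A B : List ℕ) → length A ≤ k → drop k (A ++ B) ≡ drop (k ∸ length A) B
drop-++-≥ k [] B _ = refl
drop-++-≥ (suc k) (a ∷ A) B (s≤s A≤k) = drop-++-≥ k A B A≤k

IsPerm⇒length : ∀ {n w} → IsPerm n w → length w ≡ n
IsPerm⇒length {n} w↭ = trans (↭-length w↭) (trans (cong length (range1≡range n)) (length-range 0 n))

IsPerm⇒fits : ∀ N A B → IsPerm N (A ++ N ∷ B) → length A + length B ≤ N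
IsPerm⇒fits N A B w↭ = begin
  length A + length B  ≡⟨ length-++ A ⟨
  length (A ++ B)      ≡⟨ IsPerm⇒length (IsPerm-delete-top N A B w↭) ⟩
  N ∸ 1                ≤⟨ m∸n≤m N 1 ⟩
  N                    ∎
  where open ≤-Reasoning

IsPerm⇒Distinct : ∀ N A B → IsPerm N (A ++ N ∷ B) → Cuts.Distinct A N B
IsPerm⇒Distinct N A B w↭ = Unique-drop-mid A N B (IsPerm⇒Unique w↭) ,
  tabulate (λ y∈ → proj₁ (IsPerm⇒bounds w↭ (widen y∈)))
  where
  widen : ∀ {y} → y ∈ A ++ B → y ∈ A ++ N ∷ B
  widen y∈ with ∈-++⁻ A y∈
  ... | inj₁ y∈A = ∈-++⁺ˡ y∈A
  ... | inj₂ y∈B = ∈-++⁺ʳ A (there y∈B)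

-- newrep(w) and the escaping cuts

newrep⊆escapes : ∀ N A B → IsPerm N (A ++ N ∷ B) → ∀ {k} → InNewrep N (A ++ N ∷ B) k →
                 k ∈ filterᵇ (Cuts.escapes A N B) (range 0 N)
newrep⊆escapes N A B w↭ {k} (in-supp , after-N)
  with InSupp⇒small-after (N ∸ 1) (A ++ B) k (IsPerm-delete-top N A B w↭)
         (subst (λ u → InSupp (N ∸ 1) u k) (delN-++-∷ N A B N∉A N∉B) in-supp)
  where
  distinct = IsPerm⇒Unique w↭
  N∉A = Unique-++-∷⇒∉ˡ A N B distinct
  N∉B = Unique-++-∷⇒∉ʳ A N B distinct
... | 1≤k , k<N-1 , y , y∈ , y≤k = ∈-filter⁺ (T? ∘ Cuts.escapes A N B) k∈range (from T-≡ escapes)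
  where
  A<k : length A < k
  A<k = subst (_≤ k) (posOf-++-∷ N A B (Unique-++-∷⇒∉ˡ A N B (IsPerm⇒Unique w↭))) after-N
  escapes : Cuts.escapes A N B k ≡ true
  escapes = ∧≡true (<⇒<ᵇ≡true A<k)
    (any-∈ (_≤ᵇ k) (subst (y ∈_) (drop-++-≥ k A B (<⇒≤ A<k)) y∈) (≤⇒≤ᵇ≡true y≤k))
  k∈range : k ∈ range 0 N
  k∈range = ∈-range⁺ 0 N 1≤k (≤-trans (n≤1+n k) (≤-trans k<N-1 (m∸n≤m N 1)))

length-newrep≤#escapes : ∀ N A B {L} → IsPerm N (A ++ N ∷ B) → Unique L →
  (∀ {k} → k ∈ L → InNewrep N (A ++ N ∷ B) k) → length L ≤ Cuts.#escapes A N B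
length-newrep≤#escapes N A B {L} w↭ distinct-L L⊆newrep = begin
  length L                                          ≤⟨ Unique⇒length≤ distinct-L (newrep⊆escapes N A B w↭ ∘ L⊆newrep) ⟩
  length (filterᵇ (Cuts.escapes A N B) (range 0 N)) ≡⟨ length-filterᵇ (Cuts.escapes A N B) (range 0 N) ⟩
  Cuts.#escapes A N B                               ∎
  where open ≤-Reasoning

Φ-nonempty : All (λ p → 1 ≤ length p) Φ
Φ-nonempty = toWitness {a? = all? (λ p → 1 ≤? length p) Φ} _

occurrence-top∈ : ∀ {N p} s → 1 ≤ length p → std s ≡ p → maxL s ≡ N → N ∈ s
occurrence-top∈ [] 1≤p refl _ = ⊥-elim (1+n≰n 1≤p)
occurrence-top∈ (x ∷ s) _ _ refl = maxL∈ x s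

corollary4p3p3 : (N : ℕ) (w : List ℕ) → IsPerm N w →
    Σ (List ℕ) (λ p → p ∈ Φ × HasNOcc N p w) →
    (L : List ℕ) → Unique L → (∀ k → (k ∈ L) ⇔ InNewrep N w k) →
    length L < count321-3412 N w
corollary4p3p3 N w w↭ (p , p∈Φ , occurs) L distinct-L L⇔newrep
  with extensions≥1⇒∃ (IsNOcc N p) [] w (subst (1 ≤_) (nOcc≡extensions N p w) occurs)
... | s , s⊆w , s-occurs
  with ==ᴸ≡true⇒≡ (std s) p (∧≡true⇒ˡ s-occurs) | ≡ᵇ≡true⇒≡ (∧≡true⇒ʳ {std s ==ᴸ p} s-occurs)
... | std≡ | max≡ with ∈-∃++ (⊆-lookup s⊆w (occurrence-top∈ s (lookup Φ-nonempty p∈Φ) std≡ max≡))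
... | A , B , refl = begin-strict
  length L                      ≤⟨ length-newrep≤#escapes N A B w↭ distinct-L (to (L⇔newrep _)) ⟩
  #escapes B                    <⟨ subst (_≤ occurrenceBound A B) (+-comm (#escapes B) 1) witnessed ⟩
  occurrenceBound A B           ≤⟨ occurrenceBound≤count321-3412 N A B (proj₁ below-N) (proj₂ below-N) ⟩
  count321-3412 N (A ++ N ∷ B)  ∎
  where
  open ≤-Reasoning
  open Cuts A N
  below-N = IsPerm⇒below-top N A B w↭
  witnessed : Slack 1 B
  witnessed = Witness⇒Slack-1 B (Φ-witness p∈Φ A B s (IsPerm⇒Unique w↭) s⊆w std≡ max≡)
                (IsPerm⇒Distinct N A B w↭) (IsPerm⇒fits N A B w↭)
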